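{- Let $q$ be an odd prime power, let $a\in\mathbb{F}_q^*$, and let $f(X):=X^4+aX^2$. Then $N:=|f(\mathbb{F}_q)|$ satisfies \[ N=\frac{3q+4+\chi(-1)-2\chi(-a)+2\chi(-2a)}{8}=\Bigl\lfloor\frac{3q+7-2\chi(-a)}{8}\Bigr\rfloor . \]
   Context: $f(\mathbb{F}_q)=\{f(x):x\in\mathbb{F}_q\}$. Here $\chi$ is the quadratic character on $\mathbb{F}_q$, with values regarded as the integers $1$ (nonzero squares), $-1$ (nonsquares), $0$ (at $0$); the displayed equalities are equalities of integers. -}

module Defs where

open import Level using (0ℓ)
open import Algebra.Bundles using (CommutativeRing)
open import Data.Nat as ℕ using (ℕ; zero; suc)
open import Data.Fin using (Fin)
import Data.Fin.Properties as FinP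
open import Data.Integer as ℤ using (ℤ)
open import Data.Product using (∃; _,_)
open import Relation.Nullary using (¬_; Dec; yes; no)
open import Relation.Binary.PropositionalEquality using (_≡_)
open import Relation.Binary.Definitions using (Decidable)

record FiniteField : Set₁ where
  field
    commRing : CommutativeRing 0ℓ 0ℓ
  open CommutativeRing commRing public
  field
    _≟_       : Decidable _≈_
    1≉0       : ¬ (1# ≈ 0#)
    inverse   : ∀ x → ¬ (x ≈ 0#) → ∃ λ y → x * y ≈ 1#
    size      : ℕ
    enum      : Fin size → Carrier
    enum-surj : ∀ x → ∃ λ i → enum i ≈ x
    enum-inj  : ∀ i j → enum i ≈ enum j → i ≡ j

countFin : ∀ {n} {P : Fin n → Set} → (∀ i → Dec (P i)) → ℕ
countFin {zero}  P? = 0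
countFin {suc n} P? with P? Fin.zero
... | yes _ = suc (countFin (λ i → P? (Fin.suc i)))
... | no  _ = countFin (λ i → P? (Fin.suc i))

module _ (F : FiniteField) where
  open FiniteField F

  isSquare? : ∀ x → Dec (∃ λ y → y * y ≈ x)
  isSquare? x with FinP.any? (λ j → (enum j * enum j) ≟ x)
  ... | yes (j , p) = yes (enum j , p)
  ... | no ¬p = no λ { (y , p) → let (j , q) = enum-surj y in
                        ¬p (j , trans (*-cong q q) p) }

  χ : Carrier → ℤ
  χ x with x ≟ 0#
  ... | yes _ = ℤ.0ℤ
  ... | no _ with isSquare? x
  ...   | yes _ = ℤ.1ℤ
  ...   | no _  = ℤ.-1ℤ

  imageSize : (Carrier → Carrier) → ℕ
  imageSize f = countFin (λ i → FinP.any? (λ j → f (enum j) ≟ enum i))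

module Submission where

open import Defs
open import Data.Nat as ℕ using (ℕ)
open import Data.Nat.DivMod using (_%_)
open import Data.Integer as ℤ using (ℤ; +_)
open import Data.Integer.DivMod using (_/_)
open import Data.Product using (_×_)
open import Relation.Nullary using (¬_)
open import Relation.Binary.PropositionalEquality using (_≡_)

open import Algebra.Bundles using (CommutativeRing)
import Algebra.Solver.Ring as Solver
open import Algebra.Solver.Ring.AlmostCommutativeRing
  using (fromCommutativeRing; _-Raw-AlmostCommutative⟶_)
open import Data.Empty using (⊥-elim)
open import Data.Fin as Fin using (Fin)
import Data.Fin.Properties as FinP
open import Data.Fin.Permutation using (Permutation′; permutation)
open import Data.Integer using (-[1+_]; 0ℤ; 1ℤ; -1ℤ)
open import Data.Integer.DivMod using (div-pos-is-/ℕ)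
import Data.Integer.Properties as ℤP
open import Data.Integer.Tactic.RingSolver using (solve-∀)
open import Data.Maybe using (Maybe; just; nothing)
open import Data.Nat using (zero; suc)
open import Data.Nat.Divisibility using (divides)
open import Data.Nat.DivMod using (m*n%n≡0; m*n/n≡m; m<n⇒m/n≡0; +-distrib-/-∣ˡ)
import Data.Nat.Properties as ℕP
open import Data.Product using (∃; _,_; proj₁; proj₂)
open import Data.Sum using (_⊎_; inj₁; inj₂; [_,_]′; reduce)
open import Function using (_∘_; id)
open import Relation.Binary.Core using (_Preserves_⟶_)
open import Relation.Binary.Definitions using (tri<; tri≈; tri>)
import Relation.Binary.PropositionalEquality as ≡
open ≡ using (_≢_)
import Relation.Binary.Reasoning.Setoid as SetoidReasoning
open import Relation.Nullary using (Dec; yes; no; ¬?)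
open import Relation.Nullary.Decidable using (_×-dec_)

open import Algebra.Properties.AbelianGroup ℤP.+-0-abelianGroup
  using () renaming (∙-cancelˡ to +-cancelˡ; inverseʳ-unique to ℤ-inverseʳ-unique)
open import Algebra.Properties.Semiring.Sum ℤP.+-*-semiring
  using (sum; sum-cong-≗; ∑-distrib-+; ∑-comm; sum-permute; *-distribˡ-sum)

-- Write f x = h (x * x) with h u = u * u + a * u.  Since h u ≈ h v iff
-- v ≈ u or v ≈ σ u := - a - u, the image of f is in bijection with a set
-- of representatives of the fibres {u, σ u} of h on the squares.  Hence
-- N = S - A, where S is the number of squares and A the number of orbits
-- {u, σ u} with u ≉ σ u consisting of squares, and T := #{u | u and σ u
-- are squares} = 2 A + B, where B = [c is a square] for the fixed point
-- c = - a / 2 of σ.  Writing 2 [u is a square] = 1 + χ u + [u ≈ 0] turns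
-- S, T and B into character sums, evaluated by ∑ χ = 0 (each nonzero
-- square has exactly two roots), the Jacobi sum ∑ χ u χ (- a - u) =
-- - χ (- 1) (as u (- a - u) = u² (- a / u - 1) and u ↦ - a / u - 1 is
-- bijective), and χ c = χ (- 2 a).  The floor formula holds because
-- 3 - χ (- 1) - 2 χ (- 2 a) ∈ {0, 2, 4, 6}.

-- Integer coefficients are interpreted through the optimised _×_, so that
-- the constants 1 and 2 denote 1# and 1# + 1# definitionally.
module IntegerCoefficientSolver {c ℓ} (R : CommutativeRing c ℓ) where
  open CommutativeRing R
  open import Algebra.Properties.Semiring.Mult.TCOptimised semiring as Mult
    using (1+×; ×-homo-+; ×1-homo-*)
  open import Algebra.Properties.Ring ring using (-‿distribˡ-*; -‿distribʳ-*)
  open import Algebra.Properties.AbelianGroup +-abelianGroup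
    using (ε⁻¹≈ε; ⁻¹-involutive; ⁻¹-∙-comm; xyx⁻¹≈y)
  open import Relation.Binary.Reasoning.Setoid setoid

  fromℤ : ℤ → Carrier
  fromℤ (+ n)      = n Mult.× 1#
  fromℤ (-[1+ n ]) = - (suc n Mult.× 1#)

  -‿homo : ∀ i → fromℤ (ℤ.- i) ≈ - fromℤ i
  -‿homo (+ zero)  = sym ε⁻¹≈ε
  -‿homo (+ suc n) = refl
  -‿homo -[1+ n ]  = sym (⁻¹-involutive _)

  ⊖-homo : ∀ m n → fromℤ (m ℤ.⊖ n) ≈ fromℤ (+ m) - fromℤ (+ n)
  ⊖-homo m       zero    = sym (trans (+-congˡ ε⁻¹≈ε) (+-identityʳ _))
  ⊖-homo zero    (suc n) = sym (+-identityˡ _)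
  ⊖-homo (suc m) (suc n) = begin
    fromℤ (suc m ℤ.⊖ suc n)                    ≡⟨ ≡.cong fromℤ (ℤP.[1+m]⊖[1+n]≡m⊖n m n) ⟩
    fromℤ (m ℤ.⊖ n)                            ≈⟨ ⊖-homo m n ⟩
    fromℤ (+ m) - fromℤ (+ n)                  ≈⟨ +-congʳ (xyx⁻¹≈y 1# _) ⟨
    (1# + fromℤ (+ m)) + - 1# - fromℤ (+ n)    ≈⟨ +-assoc _ _ _ ⟩
    (1# + fromℤ (+ m)) + (- 1# - fromℤ (+ n))  ≈⟨ +-congˡ (⁻¹-∙-comm 1# _) ⟩
    (1# + fromℤ (+ m)) - (1# + fromℤ (+ n))    ≈⟨ +-cong (1+× m 1#) (-‿cong (1+× n 1#)) ⟨
    fromℤ (+ suc m) - fromℤ (+ suc n)          ∎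

  +-homo : ∀ i j → fromℤ (i ℤ.+ j) ≈ fromℤ i + fromℤ j
  +-homo (+ m)     (+ n)     = ×-homo-+ 1# m n
  +-homo (+ m)     -[1+ n ]  = ⊖-homo m (suc n)
  +-homo -[1+ m ]  (+ n)     = trans (⊖-homo n (suc m)) (+-comm _ _)
  +-homo -[1+ m ]  -[1+ n ]  = begin
    - fromℤ (+ suc (suc (m ℕ.+ n)))        ≡⟨ ≡.cong (λ k → - fromℤ (+ k)) (ℕP.+-suc (suc m) n) ⟨
    - fromℤ (+ (suc m ℕ.+ suc n))          ≈⟨ -‿cong (×-homo-+ 1# (suc m) (suc n)) ⟩
    - (fromℤ (+ suc m) + fromℤ (+ suc n))  ≈⟨ ⁻¹-∙-comm _ _ ⟨
    fromℤ -[1+ m ] + fromℤ -[1+ n ]        ∎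

  *-homo-+ : ∀ m j → fromℤ (+ m ℤ.* j) ≈ fromℤ (+ m) * fromℤ j
  *-homo-+ m (+ n)     = trans (reflexive (≡.cong fromℤ (≡.sym (ℤP.pos-* m n)))) (×1-homo-* m n)
  *-homo-+ m -[1+ n ]  = begin
    fromℤ (+ m ℤ.* -[1+ n ])           ≡⟨ ≡.cong fromℤ (ℤP.neg-distribʳ-* (+ m) (+ suc n)) ⟨
    fromℤ (ℤ.- (+ m ℤ.* + suc n))      ≈⟨ -‿homo (+ m ℤ.* + suc n) ⟩
    - fromℤ (+ m ℤ.* + suc n)          ≈⟨ -‿cong (*-homo-+ m (+ suc n)) ⟩
    - (fromℤ (+ m) * fromℤ (+ suc n))  ≈⟨ -‿distribʳ-* _ _ ⟩
    fromℤ (+ m) * fromℤ -[1+ n ]       ∎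

  *-homo : ∀ i j → fromℤ (i ℤ.* j) ≈ fromℤ i * fromℤ j
  *-homo (+ m)    j = *-homo-+ m j
  *-homo -[1+ m ] j = begin
    fromℤ (-[1+ m ] ℤ.* j)         ≡⟨ ≡.cong fromℤ (ℤP.neg-distribˡ-* (+ suc m) j) ⟨
    fromℤ (ℤ.- (+ suc m ℤ.* j))    ≈⟨ -‿homo (+ suc m ℤ.* j) ⟩
    - fromℤ (+ suc m ℤ.* j)        ≈⟨ -‿cong (*-homo-+ (suc m) j) ⟩
    - (fromℤ (+ suc m) * fromℤ j)  ≈⟨ -‿distribˡ-* _ _ ⟩
    fromℤ -[1+ m ] * fromℤ j       ∎

  fromℤ-morphism : ℤ.+-*-rawRing -Raw-AlmostCommutative⟶ fromCommutativeRing R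
  fromℤ-morphism = record
    { ⟦_⟧ = fromℤ ; +-homo = +-homo ; *-homo = *-homo ; -‿homo = -‿homo
    ; 0-homo = refl ; 1-homo = refl }

  fromℤ-equal? : ∀ i j → Maybe (fromℤ i ≈ fromℤ j)
  fromℤ-equal? i j with i ℤP.≟ j
  ... | yes i≡j = just (reflexive (≡.cong fromℤ i≡j))
  ... | no _    = nothing

  open Solver ℤ.+-*-rawRing (fromCommutativeRing R) fromℤ-morphism fromℤ-equal? public

module IntegerArithmetic where
  open Data.Integer using (_+_; _*_; -_; _-_; _≤_)

  *-distribʳ-+₃ : ∀ x y z w → (x + y + z) * w ≡ x * w + y * w + z * w
  *-distribʳ-+₃ = solve-∀

  *-distribˡ-+₃ : ∀ w x y z → w * (x + y + z) ≡ w * x + w * y + w * z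
  *-distribˡ-+₃ = solve-∀

  8[s-x]≡3q+4+Y-2X+2Z : ∀ {s x b t q X Y Z} → + 2 * s ≡ q + 1ℤ → t ≡ + 2 * x + b →
                        + 4 * t ≡ q + + 2 + + 2 * X - Y → + 2 * b ≡ 1ℤ + Z →
                        + 8 * (s - x) ≡ + 3 * q + + 4 + Y - + 2 * X + + 2 * Z
  8[s-x]≡3q+4+Y-2X+2Z {s} {x} {b} {t} {q} {X} {Y} {Z} 2s≡ t≡ 4t≡ 2b≡ = begin
    + 8 * (s - x)
      ≡⟨ regroup s x b ⟩
    + 4 * (+ 2 * s) - + 4 * (+ 2 * x + b) + + 2 * (+ 2 * b)
      ≡⟨ ≡.cong (λ u → + 4 * (+ 2 * s) - + 4 * u + + 2 * (+ 2 * b)) t≡ ⟨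
    + 4 * (+ 2 * s) - + 4 * t + + 2 * (+ 2 * b)
      ≡⟨ ≡.cong₂ (λ u v → + 4 * u - v + + 2 * (+ 2 * b)) 2s≡ 4t≡ ⟩
    + 4 * (q + 1ℤ) - (q + + 2 + + 2 * X - Y) + + 2 * (+ 2 * b)
      ≡⟨ ≡.cong (λ u → + 4 * (q + 1ℤ) - (q + + 2 + + 2 * X - Y) + + 2 * u) 2b≡ ⟩
    + 4 * (q + 1ℤ) - (q + + 2 + + 2 * X - Y) + + 2 * (1ℤ + Z)
      ≡⟨ collect q X Y Z ⟩
    + 3 * q + + 4 + Y - + 2 * X + + 2 * Z
      ∎
    where
    open ≡.≡-Reasoning
    regroup : ∀ s x b → + 8 * (s - x) ≡ + 4 * (+ 2 * s) - + 4 * (+ 2 * x + b) + + 2 * (+ 2 * b)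
    regroup = solve-∀
    collect : ∀ q X Y Z → + 4 * (q + 1ℤ) - (q + + 2 + + 2 * X - Y) + + 2 * (1ℤ + Z)
                          ≡ + 3 * q + + 4 + Y - + 2 * X + + 2 * Z
    collect = solve-∀

  odd≢2* : ∀ {n} → n % 2 ≡ 1 → ∀ {k} → 0ℤ ≤ k → + n ≢ + 2 * k
  odd≢2* {n} odd {+ k} _ n≡2k = 1≢0 (≡.trans (≡.sym odd) (≡.trans (≡.cong (_% 2) n≡k*2) (m*n%n≡0 k 2)))
    where
    1≢0 : 1 ≢ 0
    1≢0 ()
    n≡k*2 : n ≡ k ℕ.* 2
    n≡k*2 = ≡.trans (ℤP.+-injective (≡.trans n≡2k (≡.sym (ℤP.pos-* 2 k)))) (ℕP.*-comm 2 k)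

  [d*n+r]/d≡n : ∀ d .{{_ : ℕ.NonZero d}} n r → r ℕ.< d → (+ d * + n + + r) / + d ≡ + n
  [d*n+r]/d≡n d n r r<d = begin
    (+ d * + n + + r) / + d     ≡⟨ ≡.cong (λ m → (m + + r) / + d) (ℤP.pos-* d n) ⟨
    + (d ℕ.* n ℕ.+ r) / + d     ≡⟨ div-pos-is-/ℕ (+ (d ℕ.* n ℕ.+ r)) d ⟩
    + ((d ℕ.* n ℕ.+ r) ℕ./ d)   ≡⟨ ≡.cong +_ (+-distrib-/-∣ˡ r (divides n (ℕP.*-comm d n))) ⟩
    + ((d ℕ.* n) ℕ./ d ℕ.+ r ℕ./ d)
      ≡⟨ ≡.cong₂ (λ x y → + (x ℕ.+ y)) (≡.trans (≡.cong (ℕ._/ d) (ℕP.*-comm d n)) (m*n/n≡m n d))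
                                       (m<n⇒m/n≡0 r<d) ⟩
    + (n ℕ.+ 0)                 ≡⟨ ≡.cong +_ (ℕP.+-identityʳ n) ⟩
    + n                         ∎
    where open ≡.≡-Reasoning

  -- 3 - y - 2 * z ∈ {0, 2, 4, 6} is the remainder modulo 8.
  N≡⌊[3q+7-2x]/8⌋ : ∀ {N q x y z} → + 8 * + N ≡ + 3 * q + + 4 + y - + 2 * x + + 2 * z →
                    y ≡ 1ℤ ⊎ y ≡ -1ℤ → z ≡ 1ℤ ⊎ z ≡ -1ℤ →
                    + N ≡ (+ 3 * q + + 7 - + 2 * x) / + 8
  N≡⌊[3q+7-2x]/8⌋ {N} {q} {x} {y} {z} eq y≡±1 z≡±1 = ≡.sym (begin
    (+ 3 * q + + 7 - + 2 * x) / + 8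
      ≡⟨ ≡.cong (_/ + 8) (≡.trans (split q x y z) (≡.cong (_+ (+ 3 - y - + 2 * z)) (≡.sym eq))) ⟩
    (+ 8 * + N + (+ 3 - y - + 2 * z)) / + 8
      ≡⟨ remainder y≡±1 z≡±1 ⟩
    + N
      ∎)
    where
    open ≡.≡-Reasoning
    split : ∀ q x y z → + 3 * q + + 7 - + 2 * x
                        ≡ (+ 3 * q + + 4 + y - + 2 * x + + 2 * z) + (+ 3 - y - + 2 * z)
    split = solve-∀
    remainder : y ≡ 1ℤ ⊎ y ≡ -1ℤ → z ≡ 1ℤ ⊎ z ≡ -1ℤ →
                (+ 8 * + N + (+ 3 - y - + 2 * z)) / + 8 ≡ + N
    remainder (inj₁ ≡.refl) (inj₁ ≡.refl) = [d*n+r]/d≡n 8 N 0 (ℕP.<ᵇ⇒< 0 8 _)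
    remainder (inj₁ ≡.refl) (inj₂ ≡.refl) = [d*n+r]/d≡n 8 N 4 (ℕP.<ᵇ⇒< 4 8 _)
    remainder (inj₂ ≡.refl) (inj₁ ≡.refl) = [d*n+r]/d≡n 8 N 2 (ℕP.<ᵇ⇒< 2 8 _)
    remainder (inj₂ ≡.refl) (inj₂ ≡.refl) = [d*n+r]/d≡n 8 N 6 (ℕP.<ᵇ⇒< 6 8 _)

open IntegerArithmetic

module FinSum where
  open Data.Integer using (_+_; _*_; -_; _-_; _≤_)

  𝟙 : ∀ {p} {P : Set p} → Dec P → ℤ
  𝟙 (yes _) = 1ℤ
  𝟙 (no _)  = 0ℤ

  module _ {p} {P : Set p} where

    𝟙-yes : (P? : Dec P) → P → 𝟙 P? ≡ 1ℤ
    𝟙-yes (yes _) _ = ≡.refl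
    𝟙-yes (no ¬p) p = ⊥-elim (¬p p)

    𝟙-no : (P? : Dec P) → ¬ P → 𝟙 P? ≡ 0ℤ
    𝟙-no (yes p) ¬p = ⊥-elim (¬p p)
    𝟙-no (no _)  _  = ≡.refl

    𝟙-nonneg : (P? : Dec P) → 0ℤ ≤ 𝟙 P?
    𝟙-nonneg (yes _) = ℤ.+≤+ ℕ.z≤n
    𝟙-nonneg (no _)  = ℤ.+≤+ ℕ.z≤n

  𝟙-⇔ : ∀ {p q} {P : Set p} {Q : Set q} (P? : Dec P) (Q? : Dec Q) →
        (P → Q) → (Q → P) → 𝟙 P? ≡ 𝟙 Q?
  𝟙-⇔ (yes p) Q? to from = ≡.sym (𝟙-yes Q? (to p))
  𝟙-⇔ (no ¬p) Q? to from = ≡.sym (𝟙-no Q? (λ q → ¬p (from q)))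

  𝟙-× : ∀ {p q} {P : Set p} {Q : Set q} (P? : Dec P) (Q? : Dec Q) → 𝟙 (P? ×-dec Q?) ≡ 𝟙 P? * 𝟙 Q?
  𝟙-× (yes _) (yes _) = ≡.refl
  𝟙-× (yes _) (no _)  = ≡.refl
  𝟙-× (no _)  _       = ≡.refl

  𝟙-¬ : ∀ {p} {P : Set p} (P? : Dec P) → 𝟙 (¬? P?) ≡ 1ℤ - 𝟙 P?
  𝟙-¬ (yes _) = ≡.refl
  𝟙-¬ (no _)  = ≡.refl

  𝟙-idem : ∀ {p} {P : Set p} (P? : Dec P) → 𝟙 P? * 𝟙 P? ≡ 𝟙 P?
  𝟙-idem (yes _) = ≡.refl
  𝟙-idem (no _)  = ≡.refl

  count≡∑𝟙 : ∀ {n} {P : Fin n → Set} (P? : ∀ i → Dec (P i)) → + countFin P? ≡ sum (λ i → 𝟙 (P? i))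
  count≡∑𝟙 {zero}  P? = ≡.refl
  count≡∑𝟙 {suc n} P? with P? Fin.zero
  ... | yes _ = ≡.cong (_+_ 1ℤ) (count≡∑𝟙 (P? ∘ Fin.suc))
  ... | no _  = ≡.trans (count≡∑𝟙 (P? ∘ Fin.suc)) (≡.sym (ℤP.+-identityˡ _))

  ∑-const : ∀ n c → sum {n} (λ _ → c) ≡ + n * c
  ∑-const zero    c = ≡.refl
  ∑-const (suc n) c = begin
    c + sum {n} (λ _ → c)  ≡⟨ ≡.cong (_+_ c) (∑-const n c) ⟩
    c + + n * c            ≡⟨ ℤP.suc-* (+ n) c ⟨
    + suc n * c            ∎
    where open ≡.≡-Reasoning

  ∑-neg : ∀ {n} (f : Fin n → ℤ) → sum (λ i → - f i) ≡ - sum f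
  ∑-neg {zero}  f = ≡.refl
  ∑-neg {suc n} f = ≡.trans (≡.cong (_+_ (- f Fin.zero)) (∑-neg (f ∘ Fin.suc)))
                            (≡.sym (ℤP.neg-distrib-+ (f Fin.zero) _))

  ∑-δ : ∀ {n} (k : Fin n) → sum (λ i → 𝟙 (i FinP.≟ k)) ≡ 1ℤ
  ∑-δ {suc n} Fin.zero    = ≡.cong (_+_ 1ℤ) (≡.trans (∑-const n 0ℤ) (ℤP.*-zeroʳ (+ n)))
  ∑-δ {suc n} (Fin.suc k) = ≡.trans (ℤP.+-identityˡ _) (≡.trans (sum-cong-≗ 𝟙-suc) (∑-δ k))
    where
    𝟙-suc : ∀ i → 𝟙 (Fin.suc i FinP.≟ Fin.suc k) ≡ 𝟙 (i FinP.≟ k)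
    𝟙-suc i = 𝟙-⇔ _ _ FinP.suc-injective (≡.cong Fin.suc)

  ∑-nonneg : ∀ {n} (f : Fin n → ℤ) → (∀ i → 0ℤ ≤ f i) → 0ℤ ≤ sum f
  ∑-nonneg {zero}  f f≥0 = ℤP.≤-refl
  ∑-nonneg {suc n} f f≥0 = ℤP.+-mono-≤ (f≥0 Fin.zero) (∑-nonneg (f ∘ Fin.suc) (f≥0 ∘ Fin.suc))

  nonneg-+≡0 : ∀ {i j} → 0ℤ ≤ i → 0ℤ ≤ j → i + j ≡ 0ℤ → i ≡ 0ℤ
  nonneg-+≡0 {+ zero}          _ _ _ = ≡.refl
  nonneg-+≡0 {+ suc m} {+ n}   _ _ ()

  ∑-nonneg≡0 : ∀ {n} (f : Fin n → ℤ) → (∀ i → 0ℤ ≤ f i) → sum f ≡ 0ℤ → ∀ i → f i ≡ 0ℤ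
  ∑-nonneg≡0 {suc n} f f≥0 ∑f≡0 Fin.zero    =
    nonneg-+≡0 (f≥0 Fin.zero) (∑-nonneg _ (f≥0 ∘ Fin.suc)) ∑f≡0
  ∑-nonneg≡0 {suc n} f f≥0 ∑f≡0 (Fin.suc i) = ∑-nonneg≡0 (f ∘ Fin.suc) (f≥0 ∘ Fin.suc) ∑tail≡0 i
    where
    ∑tail≡0 : sum (f ∘ Fin.suc) ≡ 0ℤ
    ∑tail≡0 = nonneg-+≡0 (∑-nonneg _ (f≥0 ∘ Fin.suc)) (f≥0 Fin.zero)
                         (≡.trans (ℤP.+-comm _ (f Fin.zero)) ∑f≡0)

  𝟙-trichotomy : ∀ {n} (i j : Fin n) → 𝟙 (j FinP.<? i) + 𝟙 (i FinP.<? j) + 𝟙 (i FinP.≟ j) ≡ 1ℤ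
  𝟙-trichotomy i j with FinP.<-cmp i j
  ... | tri< i<j i≢j j≮i
    rewrite 𝟙-no (j FinP.<? i) j≮i | 𝟙-yes (i FinP.<? j) i<j | 𝟙-no (i FinP.≟ j) i≢j = ≡.refl
  ... | tri≈ i≮j i≡j j≮i
    rewrite 𝟙-no (j FinP.<? i) j≮i | 𝟙-no (i FinP.<? j) i≮j | 𝟙-yes (i FinP.≟ j) i≡j = ≡.refl
  ... | tri> i≮j i≢j j<i
    rewrite 𝟙-yes (j FinP.<? i) j<i | 𝟙-no (i FinP.<? j) i≮j | 𝟙-no (i FinP.≟ j) i≢j = ≡.refl

  ∑-involution : ∀ {n} (σ : Fin n → Fin n) → (∀ i → σ (σ i) ≡ i) →
                 (w : Fin n → ℤ) → (∀ i → w (σ i) ≡ w i) →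
                 sum w ≡ + 2 * sum (λ i → w i * 𝟙 (σ i FinP.<? i))
                         + sum (λ i → w i * 𝟙 (i FinP.≟ σ i))
  ∑-involution {n} σ σσ w wσ = begin
    sum w                        ≡⟨ sum-cong-≗ split ⟩
    sum (λ i → A i + B i + C i)  ≡⟨ ≡.trans (∑-distrib-+ _ C) (≡.cong (_+ sum C) (∑-distrib-+ A B)) ⟩
    sum A + sum B + sum C        ≡⟨ ≡.cong (λ x → sum A + x + sum C) ∑B≡∑A ⟩
    sum A + sum A + sum C        ≡⟨ ≡.cong (_+ sum C) (x+x≡2x (sum A)) ⟩
    + 2 * sum A + sum C          ∎
    where
    open ≡.≡-Reasoning
    x+x≡2x : ∀ x → x + x ≡ + 2 * x
    x+x≡2x = solve-∀
    A B C : Fin n → ℤ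
    A i = w i * 𝟙 (σ i FinP.<? i)
    B i = w i * 𝟙 (i FinP.<? σ i)
    C i = w i * 𝟙 (i FinP.≟ σ i)
    split : ∀ i → w i ≡ A i + B i + C i
    split i = begin
      w i       ≡⟨ ℤP.*-identityʳ (w i) ⟨
      w i * 1ℤ  ≡⟨ ≡.cong (w i *_) (𝟙-trichotomy i (σ i)) ⟨
      w i * (𝟙 (σ i FinP.<? i) + 𝟙 (i FinP.<? σ i) + 𝟙 (i FinP.≟ σ i))
        ≡⟨ *-distribˡ-+₃ (w i) _ _ _ ⟩
      A i + B i + C i ∎
    ∑B≡∑A : sum B ≡ sum A
    ∑B≡∑A = begin
      sum B        ≡⟨ sum-permute B (permutation σ σ σσ σσ) ⟩
      sum (B ∘ σ)  ≡⟨ sum-cong-≗ (λ i → ≡.cong₂ _*_ (wσ i) (≡.cong (λ k → 𝟙 (σ i FinP.<? k)) (σσ i))) ⟩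
      sum A        ∎

open FinSum

select : ∀ {n} {P : Fin n → Set} (P? : ∀ i → Dec (P i)) → Fin (countFin P?) → ∃ P
select {suc _} P? k with P? Fin.zero
select {suc _} P? Fin.zero    | yes p = Fin.zero , p
select {suc _} P? (Fin.suc k) | yes _ = let i , p = select (P? ∘ Fin.suc) k in Fin.suc i , p
select {suc _} P? k           | no _  = let i , p = select (P? ∘ Fin.suc) k in Fin.suc i , p

select-injective : ∀ {n} {P : Fin n → Set} (P? : ∀ i → Dec (P i)) (k l : Fin (countFin P?)) →
                   proj₁ (select P? k) ≡ proj₁ (select P? l) → k ≡ l
select-injective {suc _} P? k l eq with P? Fin.zero
select-injective {suc _} P? Fin.zero    Fin.zero    eq | yes _ = ≡.refl
select-injective {suc _} P? (Fin.suc k) (Fin.suc l) eq | yes _ =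
  ≡.cong Fin.suc (select-injective (P? ∘ Fin.suc) k l (FinP.suc-injective eq))
select-injective {suc _} P? k           l           eq | no _  =
  select-injective (P? ∘ Fin.suc) k l (FinP.suc-injective eq)

rank : ∀ {n} {P : Fin n → Set} (P? : ∀ i → Dec (P i)) (i : Fin n) → P i → Fin (countFin P?)
rank {suc _} P? i p with P? Fin.zero
rank {suc _} P? Fin.zero    p | yes _  = Fin.zero
rank {suc _} P? (Fin.suc i) p | yes _  = Fin.suc (rank (P? ∘ Fin.suc) i p)
rank {suc _} P? Fin.zero    p | no ¬p  = ⊥-elim (¬p p)
rank {suc _} P? (Fin.suc i) p | no _   = rank (P? ∘ Fin.suc) i p

rank-injective : ∀ {n} {P : Fin n → Set} (P? : ∀ i → Dec (P i)) (i j : Fin n) (p : P i) (p′ : P j) →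
                 rank P? i p ≡ rank P? j p′ → i ≡ j
rank-injective {suc _} P? i j p p′ eq with P? Fin.zero
rank-injective {suc _} P? Fin.zero    Fin.zero    p p′ eq | yes _ = ≡.refl
rank-injective {suc _} P? (Fin.suc i) (Fin.suc j) p p′ eq | yes _ =
  ≡.cong Fin.suc (rank-injective (P? ∘ Fin.suc) i j p p′ (FinP.suc-injective eq))
rank-injective {suc _} P? Fin.zero    _           p p′ eq | no ¬p = ⊥-elim (¬p p)
rank-injective {suc _} P? (Fin.suc i) Fin.zero    p p′ eq | no ¬p = ⊥-elim (¬p p′)
rank-injective {suc _} P? (Fin.suc i) (Fin.suc j) p p′ eq | no _  =
  ≡.cong Fin.suc (rank-injective (P? ∘ Fin.suc) i j p p′ eq)

injection⇒count≤ : ∀ {m n} {P : Fin m → Set} {Q : Fin n → Set}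
          (P? : ∀ i → Dec (P i)) (Q? : ∀ j → Dec (Q j)) →
          (g : ∀ i → P i → ∃ Q) → (∀ i j p p′ → proj₁ (g i p) ≡ proj₁ (g j p′) → i ≡ j) →
          countFin P? ℕ.≤ countFin Q?
injection⇒count≤ P? Q? g g-injective = FinP.injective⇒≤ {f = g′} g′-injective
  where
  g′ : Fin (countFin P?) → Fin (countFin Q?)
  g′ k = let i , p = select P? k ; j , q = g i p in rank Q? j q
  g′-injective : ∀ {k l} → g′ k ≡ g′ l → k ≡ l
  g′-injective {k} {l} eq =
    select-injective P? k l (g-injective _ _ _ _ (rank-injective Q? _ _ _ _ eq))

bijection⇒count≡ : ∀ {m n} {P : Fin m → Set} {Q : Fin n → Set}
          (P? : ∀ i → Dec (P i)) (Q? : ∀ j → Dec (Q j)) →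
          (g : Fin m → Fin n) → (∀ i → P i → Q (g i)) →
          (∀ i j → P i → P j → g i ≡ g j → i ≡ j) →
          (∀ j → Q j → ∃ λ i → P i × g i ≡ j) →
          countFin P? ≡ countFin Q?
bijection⇒count≡ {P = P} {Q} P? Q? g g-Q g-injective g-onto = ℕP.≤-antisym
  (injection⇒count≤ P? Q? (λ i p → g i , g-Q i p) g-injective)
  (injection⇒count≤ Q? P? preimage preimage-injective)
  where
  preimage : ∀ j → Q j → ∃ P
  preimage j q = let i , p , _ = g-onto j q in i , p
  preimage-injective : ∀ j k q q′ → proj₁ (preimage j q) ≡ proj₁ (preimage k q′) → j ≡ k
  preimage-injective j k q q′ eq with g-onto j q | g-onto k q′ | eq
  ... | i , _ , gi≡j | .i , _ , gi≡k | ≡.refl = ≡.trans (≡.sym gi≡j) gi≡k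

module FiniteFieldTheory (F : FiniteField) where
  open FiniteField F
  open IntegerCoefficientSolver commRing using (solve; _:=_; _:+_; _:*_; :-_; _:-_; con)
  open import Algebra.Properties.AbelianGroup +-abelianGroup
    using (ε⁻¹≈ε; ⁻¹-injective; x∙y⁻¹≈ε⇒x≈y)
  module ≈-Reasoning = SetoidReasoning setoid

  index : Carrier → Fin size
  index x = proj₁ (enum-surj x)

  enum-index : ∀ x → enum (index x) ≈ x
  enum-index x = proj₂ (enum-surj x)

  index-cong : ∀ {x y} → x ≈ y → index x ≡ index y
  index-cong {x} {y} x≈y = enum-inj _ _ (trans (enum-index x) (trans x≈y (sym (enum-index y))))

  index-enum : ∀ i → index (enum i) ≡ i
  index-enum i = enum-inj _ _ (enum-index (enum i))

  index-injective : ∀ {x y} → index x ≡ index y → x ≈ y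
  index-injective {x} {y} eq =
    trans (sym (enum-index x)) (trans (reflexive (≡.cong enum eq)) (enum-index y))

  lift : (Carrier → Carrier) → Fin size → Fin size
  lift b = index ∘ b ∘ enum

  lift-inverse : ∀ {b b′} → b Preserves _≈_ ⟶ _≈_ → (∀ x → b (b′ x) ≈ x) →
                 ∀ i → lift b (lift b′ i) ≡ i
  lift-inverse b-cong bb′ i = ≡.trans (index-cong (trans (b-cong (enum-index _)) (bb′ _))) (index-enum i)

  δ : Carrier → Carrier → ℤ
  δ c x = 𝟙 (x ≟ c)

  δ-cong : ∀ c → δ c Preserves _≈_ ⟶ _≡_
  δ-cong c x≈y = 𝟙-⇔ _ _ (trans (sym x≈y)) (trans x≈y)

  -- Opaque, so that φ can be recovered from ∑F φ by unification.
  opaque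
    ∑F : (Carrier → ℤ) → ℤ
    ∑F φ = sum (φ ∘ enum)

    ∑F-def : ∀ φ → ∑F φ ≡ sum (φ ∘ enum)
    ∑F-def φ = ≡.refl

    ∑F-cong : ∀ {φ ψ} → (∀ x → φ x ≡ ψ x) → ∑F φ ≡ ∑F ψ
    ∑F-cong φ≗ψ = sum-cong-≗ (φ≗ψ ∘ enum)

    ∑F-+ : ∀ φ ψ → ∑F (λ x → φ x ℤ.+ ψ x) ≡ ∑F φ ℤ.+ ∑F ψ
    ∑F-+ φ ψ = ∑-distrib-+ (φ ∘ enum) (ψ ∘ enum)

    ∑F-neg : ∀ φ → ∑F (λ x → ℤ.- φ x) ≡ ℤ.- ∑F φ
    ∑F-neg φ = ∑-neg (φ ∘ enum)

    ∑F-*ˡ : ∀ c φ → ∑F (λ x → c ℤ.* φ x) ≡ c ℤ.* ∑F φ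
    ∑F-*ˡ c φ = ≡.sym (*-distribˡ-sum c (φ ∘ enum))

    ∑F-const : ∀ c → ∑F (λ _ → c) ≡ + size ℤ.* c
    ∑F-const = ∑-const size

    ∑F-comm : ∀ (φ : Carrier → Carrier → ℤ) →
              ∑F (λ x → ∑F (φ x)) ≡ ∑F (λ y → ∑F (λ x → φ x y))
    ∑F-comm φ = ∑-comm (λ i j → φ (enum i) (enum j))

    ∑F-reindex : ∀ {b b′} → b Preserves _≈_ ⟶ _≈_ → b′ Preserves _≈_ ⟶ _≈_ →
                 (∀ x → b (b′ x) ≈ x) → (∀ x → b′ (b x) ≈ x) →
                 ∀ {φ} → φ Preserves _≈_ ⟶ _≡_ → ∑F (φ ∘ b) ≡ ∑F φ
    ∑F-reindex {b} {b′} b-cong b′-cong bb′ b′b {φ} φ-cong = ≡.sym (begin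
      sum (φ ∘ enum)                ≡⟨ sum-permute (φ ∘ enum) π ⟩
      sum (φ ∘ enum ∘ lift b)       ≡⟨ sum-cong-≗ (λ i → φ-cong (enum-index (b (enum i)))) ⟩
      sum (φ ∘ b ∘ enum)            ∎)
      where
      open ≡.≡-Reasoning
      π : Permutation′ size
      π = permutation (lift b) (lift b′) (lift-inverse b-cong bb′) (lift-inverse b′-cong b′b)

    ∑F-reindex-involution : ∀ {b} → b Preserves _≈_ ⟶ _≈_ → (∀ x → b (b x) ≈ x) →
                            ∀ {φ} → φ Preserves _≈_ ⟶ _≡_ → ∑F (φ ∘ b) ≡ ∑F φ
    ∑F-reindex-involution b-cong bb = ∑F-reindex b-cong b-cong bb bb

    ∑F-nonneg≡0 : ∀ {φ} → φ Preserves _≈_ ⟶ _≡_ → (∀ x → 0ℤ ℤ.≤ φ x) → ∑F φ ≡ 0ℤ →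
                  ∀ x → φ x ≡ 0ℤ
    ∑F-nonneg≡0 {φ} φ-cong φ≥0 ∑φ≡0 x =
      ≡.trans (φ-cong (sym (enum-index x))) (∑-nonneg≡0 (φ ∘ enum) (φ≥0 ∘ enum) ∑φ≡0 (index x))

    ∑F-δ : ∀ c → ∑F (δ c) ≡ 1ℤ
    ∑F-δ c = ≡.trans (sum-cong-≗ δ≗) (∑-δ (index c))
      where
      δ≗ : ∀ i → δ c (enum i) ≡ 𝟙 (i FinP.≟ index c)
      δ≗ i = 𝟙-⇔ _ _ (λ eq → ≡.trans (≡.sym (index-enum i)) (index-cong eq))
                     (λ eq → trans (reflexive (≡.cong enum eq)) (enum-index c))

  ∑F-δ-* : ∀ c {φ} → φ Preserves _≈_ ⟶ _≡_ → ∑F (λ x → δ c x ℤ.* φ x) ≡ φ c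
  ∑F-δ-* c {φ} φ-cong = begin
    ∑F (λ x → δ c x ℤ.* φ x)   ≡⟨ ∑F-cong δφ≗ ⟩
    ∑F (λ x → φ c ℤ.* δ c x)   ≡⟨ ∑F-*ˡ (φ c) (δ c) ⟩
    φ c ℤ.* ∑F (δ c)           ≡⟨ ≡.cong (φ c ℤ.*_) (∑F-δ c) ⟩
    φ c ℤ.* 1ℤ                 ≡⟨ ℤP.*-identityʳ (φ c) ⟩
    φ c                        ∎
    where
    open ≡.≡-Reasoning
    δφ≗ : ∀ x → δ c x ℤ.* φ x ≡ φ c ℤ.* δ c x
    δφ≗ x with x ≟ c
    ... | yes x≈c = ≡.trans (ℤP.*-comm 1ℤ (φ x)) (≡.cong (ℤ._* 1ℤ) (φ-cong x≈c))
    ... | no _    = ≡.sym (ℤP.*-zeroʳ (φ c))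

  δ-sym : ∀ x y → δ x y ≡ δ y x
  δ-sym x y = 𝟙-⇔ _ _ sym sym

  ∑F-1 : ∑F (λ _ → 1ℤ) ≡ + size
  ∑F-1 = ≡.trans (∑F-const 1ℤ) (ℤP.*-identityʳ (+ size))

  -x≈0⇒x≈0 : ∀ {x} → - x ≈ 0# → x ≈ 0#
  -x≈0⇒x≈0 -x≈0 = ⁻¹-injective (trans -x≈0 (sym ε⁻¹≈ε))

  x+y≈0⇒y≈-x : ∀ {x y} → x + y ≈ 0# → y ≈ - x
  x+y≈0⇒y≈-x {x} {y} x+y≈0 = x∙y⁻¹≈ε⇒x≈y y (- x)
    (trans (solve 2 (λ x y → y :- (:- x) := x :+ y) refl x y) x+y≈0)

  zero-product : ∀ {x y} → x * y ≈ 0# → x ≈ 0# ⊎ y ≈ 0#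
  zero-product {x} {y} xy≈0 with x ≟ 0#
  ... | yes x≈0 = inj₁ x≈0
  ... | no x≉0  = inj₂ (begin
    y              ≈⟨ *-identityˡ y ⟨
    1# * y         ≈⟨ *-congʳ (proj₂ (inverse x x≉0)) ⟨
    (x * x⁻¹) * y  ≈⟨ solve 3 (λ x x⁻¹ y → (x :* x⁻¹) :* y := x⁻¹ :* (x :* y)) refl x x⁻¹ y ⟩
    x⁻¹ * (x * y)  ≈⟨ *-congˡ xy≈0 ⟩
    x⁻¹ * 0#       ≈⟨ zeroʳ x⁻¹ ⟩
    0#             ∎)
    where
    open ≈-Reasoning
    x⁻¹ : Carrier
    x⁻¹ = proj₁ (inverse x x≉0)

  *-≉0 : ∀ {x y} → x ≉ 0# → y ≉ 0# → x * y ≉ 0#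
  *-≉0 x≉0 y≉0 xy≈0 with zero-product xy≈0
  ... | inj₁ x≈0 = x≉0 x≈0
  ... | inj₂ y≈0 = y≉0 y≈0

  square-roots : ∀ {y z} → y * y ≈ z * z → y ≈ z ⊎ y ≈ - z
  square-roots {y} {z} yy≈zz with zero-product {y - z} {z + y} factored
    where
    factored : (y - z) * (z + y) ≈ 0#
    factored = trans (solve 2 (λ y z → (y :- z) :* (z :+ y) := y :* y :- z :* z) refl y z)
                     (trans (+-congʳ yy≈zz) (-‿inverseʳ (z * z)))
  ... | inj₁ y-z≈0 = inj₁ (x∙y⁻¹≈ε⇒x≈y y z y-z≈0)
  ... | inj₂ z+y≈0 = inj₂ (x+y≈0⇒y≈-x z+y≈0)

  -- Junk value: inv 0# = 0#.
  inv : Carrier → Carrier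
  inv x with x ≟ 0#
  ... | yes _   = 0#
  ... | no x≉0  = proj₁ (inverse x x≉0)

  *-inv : ∀ {x} → x ≉ 0# → x * inv x ≈ 1#
  *-inv {x} x≉0 with x ≟ 0#
  ... | yes x≈0  = ⊥-elim (x≉0 x≈0)
  ... | no x≉0′  = proj₂ (inverse x x≉0′)

  inv-≈0 : ∀ {x} → x ≈ 0# → inv x ≈ 0#
  inv-≈0 {x} x≈0 with x ≟ 0#
  ... | yes _   = refl
  ... | no x≉0  = ⊥-elim (x≉0 x≈0)

  inv-≉0 : ∀ {x} → x ≉ 0# → inv x ≉ 0#
  inv-≉0 {x} x≉0 x⁻¹≈0 = 1≉0 (trans (sym (*-inv x≉0)) (trans (*-congˡ x⁻¹≈0) (zeroʳ x)))

  *-solveˡ : ∀ {x y z} → x ≉ 0# → x * y ≈ z → y ≈ inv x * z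
  *-solveˡ {x} {y} {z} x≉0 xy≈z = begin
    y                  ≈⟨ *-identityʳ y ⟨
    y * 1#             ≈⟨ *-congˡ (*-inv x≉0) ⟨
    y * (x * inv x)    ≈⟨ solve 3 (λ x y x⁻¹ → y :* (x :* x⁻¹) := x⁻¹ :* (x :* y)) refl x y (inv x) ⟩
    inv x * (x * y)    ≈⟨ *-congˡ xy≈z ⟩
    inv x * z          ∎
    where open ≈-Reasoning

  inverse-unique : ∀ {x y} → x * y ≈ 1# → y ≈ inv x
  inverse-unique {x} {y} xy≈1 = trans (*-solveˡ x≉0 xy≈1) (*-identityʳ (inv x))
    where
    x≉0 : x ≉ 0#
    x≉0 x≈0 = 1≉0 (trans (sym xy≈1) (trans (*-congʳ x≈0) (zeroˡ y)))

  inv-cong : ∀ {x y} → x ≈ y → inv x ≈ inv y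
  inv-cong {x} {y} x≈y = by-cases (x ≟ 0#)
    where
    by-cases : Dec (x ≈ 0#) → inv x ≈ inv y
    by-cases (yes x≈0) = trans (inv-≈0 x≈0) (sym (inv-≈0 (trans (sym x≈y) x≈0)))
    by-cases (no x≉0)  = inverse-unique (trans (*-congʳ (sym x≈y)) (*-inv x≉0))

  inv-involutive : ∀ x → inv (inv x) ≈ x
  inv-involutive x = by-cases (x ≟ 0#)
    where
    by-cases : Dec (x ≈ 0#) → inv (inv x) ≈ x
    by-cases (yes x≈0) = trans (inv-≈0 (inv-≈0 x≈0)) (sym x≈0)
    by-cases (no x≉0)  = sym (inverse-unique (trans (*-comm (inv x) x) (*-inv x≉0)))

  ∑F-reindex-* : ∀ {c} → c ≉ 0# → ∀ {φ} → φ Preserves _≈_ ⟶ _≡_ → ∑F (λ x → φ (c * x)) ≡ ∑F φ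
  ∑F-reindex-* {c} c≉0 = ∑F-reindex *-congˡ *-congˡ (cancel c (inv c) (*-inv c≉0))
                                                     (cancel (inv c) c (trans (*-comm (inv c) c) (*-inv c≉0)))
    where
    cancel : ∀ y z → y * z ≈ 1# → ∀ x → y * (z * x) ≈ x
    cancel y z yz≈1 x = trans (sym (*-assoc y z x)) (trans (*-congʳ yz≈1) (*-identityˡ x))

  ∑F-reindex-+ : ∀ c {φ} → φ Preserves _≈_ ⟶ _≡_ → ∑F (λ x → φ (x + c)) ≡ ∑F φ
  ∑F-reindex-+ c = ∑F-reindex +-congʳ +-congʳ
    (solve 2 (λ c x → (x :- c) :+ c := x) refl c) (solve 2 (λ c x → (x :+ c) :- c := x) refl c)

  u[c-u]≈uu[c/u-1] : ∀ {u} c → u ≉ 0# → u * (c - u) ≈ (u * u) * (c * inv u - 1#)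
  u[c-u]≈uu[c/u-1] {u} c u≉0 = begin
    u * (c - u)                  ≈⟨ solve 2 (λ u c → u :* (c :- u) := c :* u :* con 1ℤ :- u :* u) refl u c ⟩
    c * u * 1# - u * u           ≈⟨ +-congʳ (*-congˡ (*-inv u≉0)) ⟨
    c * u * (u * inv u) - u * u  ≈⟨ solve 3 (λ u c u⁻¹ → c :* u :* (u :* u⁻¹) :- u :* u
                                                        := (u :* u) :* (c :* u⁻¹ :- con 1ℤ)) refl u c (inv u) ⟩
    (u * u) * (c * inv u - 1#)   ∎
    where open ≈-Reasoning

  2# : Carrier
  2# = 1# + 1#

  -- If 2# ≈ 0#, then x ↦ x + 1# is an involution without fixed points.
  odd-size⇒2≉0 : size % 2 ≡ 1 → 2# ≉ 0#
  odd-size⇒2≉0 odd 2≈0 = odd≢2* odd (∑-nonneg _ (λ i → 𝟙-nonneg (σ i FinP.<? i))) size≡2A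
    where
    open ≡.≡-Reasoning
    σ : Fin size → Fin size
    σ = lift (_+ 1#)
    σ-involutive : ∀ i → σ (σ i) ≡ i
    σ-involutive = lift-inverse +-congʳ
      (λ x → trans (+-assoc x 1# 1#) (trans (+-congˡ 2≈0) (+-identityʳ x)))
    x≉x+1 : ∀ x → x ≉ x + 1#
    x≉x+1 x x≈x+1 = 1≉0 (trans (solve 1 (λ x → con 1ℤ := (x :+ con 1ℤ) :- x) refl x)
                              (trans (+-congʳ (sym x≈x+1)) (-‿inverseʳ x)))
    no-fixed-point : ∀ i → 1ℤ ℤ.* 𝟙 (i FinP.≟ σ i) ≡ 0ℤ
    no-fixed-point i = ≡.trans (ℤP.*-identityˡ _) (𝟙-no (i FinP.≟ σ i)
      (λ i≡σi → x≉x+1 (enum i) (trans (reflexive (≡.cong enum i≡σi)) (enum-index _))))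
    size≡2A : + size ≡ + 2 ℤ.* sum (λ i → 𝟙 (σ i FinP.<? i))
    size≡2A = begin
      + size                 ≡⟨ ℤP.*-identityʳ (+ size) ⟨
      + size ℤ.* 1ℤ          ≡⟨ ∑-const size 1ℤ ⟨
      sum {size} (λ _ → 1ℤ)  ≡⟨ ∑-involution σ σ-involutive (λ _ → 1ℤ) (λ _ → ≡.refl) ⟩
      + 2 ℤ.* sum (λ i → 1ℤ ℤ.* 𝟙 (σ i FinP.<? i)) ℤ.+ sum (λ i → 1ℤ ℤ.* 𝟙 (i FinP.≟ σ i))
        ≡⟨ ≡.cong₂ (λ x y → + 2 ℤ.* x ℤ.+ y)
                   (sum-cong-≗ (λ i → ℤP.*-identityˡ (𝟙 (σ i FinP.<? i))))
                   (≡.trans (sum-cong-≗ no-fixed-point) (≡.trans (∑-const size 0ℤ) (ℤP.*-zeroʳ (+ size)))) ⟩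
      + 2 ℤ.* sum (λ i → 𝟙 (σ i FinP.<? i)) ℤ.+ 0ℤ
        ≡⟨ ℤP.+-identityʳ _ ⟩
      + 2 ℤ.* sum (λ i → 𝟙 (σ i FinP.<? i)) ∎

  Square : Carrier → Set
  Square x = ∃ λ y → y * y ≈ x

  square-cong : ∀ {x y} → x ≈ y → Square x → Square y
  square-cong x≈y (r , rr≈x) = r , trans rr≈x x≈y

  ≈0⇒square : ∀ {x} → x ≈ 0# → Square x
  ≈0⇒square x≈0 = 0# , trans (zeroˡ 0#) (sym x≈0)

  data Quadratic (x : Carrier) : Set where
    is-zero      : x ≈ 0# → Quadratic x
    is-square    : x ≉ 0# → Square x → Quadratic x
    is-nonsquare : ¬ Square x → Quadratic x

  quadratic : ∀ x → Quadratic x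
  quadratic x with x ≟ 0# | isSquare? F x
  ... | yes x≈0 | _        = is-zero x≈0
  ... | no x≉0  | yes x-sq = is-square x≉0 x-sq
  ... | no _    | no x-nsq = is-nonsquare x-nsq

  χ-≈0 : ∀ {x} → x ≈ 0# → χ F x ≡ 0ℤ
  χ-≈0 {x} x≈0 with x ≟ 0#
  ... | yes _  = ≡.refl
  ... | no x≉0 = ⊥-elim (x≉0 x≈0)

  χ-square : ∀ {x} → x ≉ 0# → Square x → χ F x ≡ 1ℤ
  χ-square {x} x≉0 x-sq with x ≟ 0#
  ... | yes x≈0 = ⊥-elim (x≉0 x≈0)
  ... | no _ with isSquare? F x
  ...   | yes _    = ≡.refl
  ...   | no x-nsq = ⊥-elim (x-nsq x-sq)

  χ-nonsquare : ∀ {x} → ¬ Square x → χ F x ≡ -1ℤ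
  χ-nonsquare {x} x-nsq with x ≟ 0#
  ... | yes x≈0 = ⊥-elim (x-nsq (≈0⇒square x≈0))
  ... | no _ with isSquare? F x
  ...   | yes x-sq = ⊥-elim (x-nsq x-sq)
  ...   | no _     = ≡.refl

  χ-cong : χ F Preserves _≈_ ⟶ _≡_
  χ-cong {x} {y} x≈y with quadratic x
  ... | is-zero x≈0          = ≡.trans (χ-≈0 x≈0) (≡.sym (χ-≈0 (trans (sym x≈y) x≈0)))
  ... | is-square x≉0 x-sq   = ≡.trans (χ-square x≉0 x-sq)
                                    (≡.sym (χ-square (λ y≈0 → x≉0 (trans x≈y y≈0)) (square-cong x≈y x-sq)))
  ... | is-nonsquare x-nsq   = ≡.trans (χ-nonsquare x-nsq)
                                    (≡.sym (χ-nonsquare (λ y-sq → x-nsq (square-cong (sym x≈y) y-sq))))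

  χ-±1 : ∀ {x} → x ≉ 0# → χ F x ≡ 1ℤ ⊎ χ F x ≡ -1ℤ
  χ-±1 {x} x≉0 with quadratic x
  ... | is-zero x≈0        = ⊥-elim (x≉0 x≈0)
  ... | is-square _ x-sq   = inj₁ (χ-square x≉0 x-sq)
  ... | is-nonsquare x-nsq = inj₂ (χ-nonsquare x-nsq)

  𝟙Sq : Carrier → ℤ
  𝟙Sq x = 𝟙 (isSquare? F x)

  𝟙Sq-cong : 𝟙Sq Preserves _≈_ ⟶ _≡_
  𝟙Sq-cong x≈y = 𝟙-⇔ _ _ (square-cong x≈y) (square-cong (sym x≈y))

  2𝟙Sq≡1+χ+δ : ∀ x → + 2 ℤ.* 𝟙Sq x ≡ 1ℤ ℤ.+ χ F x ℤ.+ δ 0# x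
  2𝟙Sq≡1+χ+δ x with quadratic x
  ... | is-zero x≈0
    rewrite 𝟙-yes (isSquare? F x) (≈0⇒square x≈0) | χ-≈0 x≈0 | 𝟙-yes (x ≟ 0#) x≈0 = ≡.refl
  ... | is-square x≉0 x-sq
    rewrite 𝟙-yes (isSquare? F x) x-sq | χ-square x≉0 x-sq | 𝟙-no (x ≟ 0#) x≉0 = ≡.refl
  ... | is-nonsquare x-nsq
    rewrite 𝟙-no (isSquare? F x) x-nsq | χ-nonsquare x-nsq
          | 𝟙-no (x ≟ 0#) (λ x≈0 → x-nsq (≈0⇒square x≈0)) = ≡.refl

  χ-*-square : ∀ {y} v → y ≉ 0# → χ F ((y * y) * v) ≡ χ F v
  χ-*-square {y} v y≉0 with quadratic v
  ... | is-zero v≈0 = ≡.trans (χ-≈0 (trans (*-congˡ v≈0) (zeroʳ _))) (≡.sym (χ-≈0 v≈0))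
  ... | is-square v≉0 (r , rr≈v) = ≡.trans (χ-square (*-≉0 (*-≉0 y≉0 y≉0) v≉0) (y * r , yr-squared))
                                         (≡.sym (χ-square v≉0 (r , rr≈v)))
    where
    yr-squared : (y * r) * (y * r) ≈ (y * y) * v
    yr-squared = trans (solve 2 (λ y r → (y :* r) :* (y :* r) := (y :* y) :* (r :* r)) refl y r)
                       (*-congˡ rr≈v)
  ... | is-nonsquare v-nsq = ≡.trans (χ-nonsquare (v-nsq ∘ unscale)) (≡.sym (χ-nonsquare v-nsq))
    where
    unscale : Square ((y * y) * v) → Square v
    unscale (t , tt≈yyv) = inv y * t , (begin
      (inv y * t) * (inv y * t)
        ≈⟨ solve 2 (λ y⁻¹ t → (y⁻¹ :* t) :* (y⁻¹ :* t) := (y⁻¹ :* y⁻¹) :* (t :* t)) refl (inv y) t ⟩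
      (inv y * inv y) * (t * t)
        ≈⟨ *-congˡ tt≈yyv ⟩
      (inv y * inv y) * ((y * y) * v)
        ≈⟨ solve 3 (λ y⁻¹ y v → (y⁻¹ :* y⁻¹) :* ((y :* y) :* v) := ((y :* y⁻¹) :* (y :* y⁻¹)) :* v)
                   refl (inv y) y v ⟩
      ((y * inv y) * (y * inv y)) * v
        ≈⟨ *-congʳ (*-cong (*-inv y≉0) (*-inv y≉0)) ⟩
      (1# * 1#) * v
        ≈⟨ trans (*-congʳ (*-identityˡ 1#)) (*-identityˡ v) ⟩
      v ∎)
      where open ≈-Reasoning

  ∑F-[1+χ+δ]* : ∀ {g} → g Preserves _≈_ ⟶ _≡_ →
                 ∑F (λ u → (1ℤ ℤ.+ χ F u ℤ.+ δ 0# u) ℤ.* g u)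
                   ≡ ∑F g ℤ.+ ∑F (λ u → χ F u ℤ.* g u) ℤ.+ g 0#
  ∑F-[1+χ+δ]* {g} g-cong = begin
    ∑F (λ u → (1ℤ ℤ.+ χ F u ℤ.+ δ 0# u) ℤ.* g u)
      ≡⟨ ∑F-cong (λ u → ≡.trans (*-distribʳ-+₃ 1ℤ (χ F u) (δ 0# u) (g u))
                                (≡.cong (λ t → t ℤ.+ χ F u ℤ.* g u ℤ.+ δ 0# u ℤ.* g u)
                                        (ℤP.*-identityˡ (g u)))) ⟩
    ∑F (λ u → g u ℤ.+ χ F u ℤ.* g u ℤ.+ δ 0# u ℤ.* g u)
      ≡⟨ ≡.trans (∑F-+ _ _) (≡.cong (ℤ._+ ∑F (λ u → δ 0# u ℤ.* g u))
                                    (∑F-+ g (λ u → χ F u ℤ.* g u))) ⟩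
    ∑F g ℤ.+ ∑F (λ u → χ F u ℤ.* g u) ℤ.+ ∑F (λ u → δ 0# u ℤ.* g u)
      ≡⟨ ≡.cong (ℤ._+_ (∑F g ℤ.+ ∑F (λ u → χ F u ℤ.* g u))) (∑F-δ-* 0# g-cong) ⟩
    ∑F g ℤ.+ ∑F (λ u → χ F u ℤ.* g u) ℤ.+ g 0#
      ∎
    where open ≡.≡-Reasoning

  module OddCharacteristic (2≉0 : 2# ≉ 0#) where

    x≈-x⇒x≈0 : ∀ {x} → x ≈ - x → x ≈ 0#
    x≈-x⇒x≈0 {x} x≈-x = [ ⊥-elim ∘ 2≉0 , id ]′ (zero-product 2x≈0)
      where
      2x≈0 : 2# * x ≈ 0#
      2x≈0 = trans (solve 1 (λ x → con (+ 2) :* x := x :+ x) refl x) (trans (+-congˡ x≈-x) (-‿inverseʳ x))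

    δ-square : ∀ {r} → r ≉ 0# → ∀ y → δ (r * r) (y * y) ≡ δ r y ℤ.+ δ (- r) y
    δ-square {r} r≉0 y with y ≟ r | y ≟ (- r)
    ... | yes y≈r | yes y≈-r = ⊥-elim (r≉0 (x≈-x⇒x≈0 (trans (sym y≈r) y≈-r)))
    ... | yes y≈r | no _     = 𝟙-yes _ (*-cong y≈r y≈r)
    ... | no _    | yes y≈-r =
      𝟙-yes _ (trans (*-cong y≈-r y≈-r) (solve 1 (λ r → (:- r) :* (:- r) := r :* r) refl r))
    ... | no y≉r  | no y≉-r  = 𝟙-no _ (λ yy≈rr → [ y≉r , y≉-r ]′ (square-roots yy≈rr))

    ∑F-δ-square : ∀ x → ∑F (λ y → δ x (y * y)) ≡ 1ℤ ℤ.+ χ F x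
    ∑F-δ-square x with quadratic x
    ... | is-zero x≈0 = begin
      ∑F (λ y → δ x (y * y))   ≡⟨ ∑F-cong (λ y → 𝟙-⇔ _ _ (yy≈x⇒y≈0 y) (y≈0⇒yy≈x y)) ⟩
      ∑F (δ 0#)                ≡⟨ ∑F-δ 0# ⟩
      1ℤ                       ≡⟨ ≡.cong (ℤ._+_ 1ℤ) (χ-≈0 x≈0) ⟨
      1ℤ ℤ.+ χ F x             ∎
      where
      open ≡.≡-Reasoning
      yy≈x⇒y≈0 : ∀ y → y * y ≈ x → y ≈ 0#
      yy≈x⇒y≈0 y yy≈x = reduce (zero-product (trans yy≈x x≈0))
      y≈0⇒yy≈x : ∀ y → y ≈ 0# → y * y ≈ x
      y≈0⇒yy≈x y y≈0 = trans (trans (*-congʳ y≈0) (zeroˡ y)) (sym x≈0)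
    ... | is-square x≉0 (r , rr≈x) = begin
      ∑F (λ y → δ x (y * y))              ≡⟨ ∑F-cong (λ y → ≡.trans (δ-cong-centre y) (δ-square r≉0 y)) ⟩
      ∑F (λ y → δ r y ℤ.+ δ (- r) y)      ≡⟨ ∑F-+ (δ r) (δ (- r)) ⟩
      ∑F (δ r) ℤ.+ ∑F (δ (- r))           ≡⟨ ≡.cong₂ ℤ._+_ (∑F-δ r) (∑F-δ (- r)) ⟩
      1ℤ ℤ.+ 1ℤ                           ≡⟨ ≡.cong (ℤ._+_ 1ℤ) (χ-square x≉0 (r , rr≈x)) ⟨
      1ℤ ℤ.+ χ F x                        ∎
      where
      open ≡.≡-Reasoning
      r≉0 : r ≉ 0#
      r≉0 r≈0 = x≉0 (trans (sym rr≈x) (trans (*-congʳ r≈0) (zeroˡ r)))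
      δ-cong-centre : ∀ y → δ x (y * y) ≡ δ (r * r) (y * y)
      δ-cong-centre y = 𝟙-⇔ _ _ (λ yy≈x → trans yy≈x (sym rr≈x)) (λ yy≈rr → trans yy≈rr rr≈x)
    ... | is-nonsquare x-nsq = begin
      ∑F (λ y → δ x (y * y))   ≡⟨ ∑F-cong (λ y → 𝟙-no _ (λ yy≈x → x-nsq (y , yy≈x))) ⟩
      ∑F (λ _ → 0ℤ)            ≡⟨ ≡.trans (∑F-const 0ℤ) (ℤP.*-zeroʳ (+ size)) ⟩
      0ℤ                       ≡⟨ ≡.cong (ℤ._+_ 1ℤ) (χ-nonsquare x-nsq) ⟨
      1ℤ ℤ.+ χ F x             ∎
      where open ≡.≡-Reasoning

    -- Counting the pairs (x, y) with y * y ≈ x in two ways.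
    ∑χ≡0 : ∑F (χ F) ≡ 0ℤ
    ∑χ≡0 = +-cancelˡ (+ size) _ _ (begin
      + size ℤ.+ ∑F (χ F)                  ≡⟨ ≡.cong (ℤ._+ ∑F (χ F)) ∑F-1 ⟨
      ∑F (λ _ → 1ℤ) ℤ.+ ∑F (χ F)           ≡⟨ ∑F-+ (λ _ → 1ℤ) (χ F) ⟨
      ∑F (λ x → 1ℤ ℤ.+ χ F x)              ≡⟨ ∑F-cong ∑F-δ-square ⟨
      ∑F (λ x → ∑F (λ y → δ x (y * y)))    ≡⟨ ∑F-comm (λ x y → δ x (y * y)) ⟩
      ∑F (λ y → ∑F (λ x → δ x (y * y)))
        ≡⟨ ∑F-cong (λ y → ≡.trans (∑F-cong (λ x → δ-sym x (y * y))) (∑F-δ (y * y))) ⟩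
      ∑F (λ _ → 1ℤ)                        ≡⟨ ∑F-1 ⟩
      + size                               ≡⟨ ℤP.+-identityʳ (+ size) ⟨
      + size ℤ.+ 0ℤ                        ∎)
      where open ≡.≡-Reasoning

    -- The terms χ x + χ (n * x) are ≤ 0 and sum to ∑ χ + ∑ χ = 0.
    χ-nonsquare-* : ∀ {n} → ¬ Square n → ∀ x → χ F (n * x) ≡ ℤ.- χ F x
    χ-nonsquare-* {n} n-nsq x =
      ℤ-inverseʳ-unique (χ F x) (χ F (n * x))
        (≡.trans (≡.sym (ℤP.neg-involutive _)) (≡.cong ℤ.-_ (∑F-nonneg≡0 t-cong t≥0 ∑t≡0 x)))
      where
      n≉0 : n ≉ 0#
      n≉0 n≈0 = n-nsq (≈0⇒square n≈0)
      χ-n*square : ∀ {s x} → x ≉ 0# → s * s ≈ x → χ F (n * x) ≡ -1ℤ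
      χ-n*square {s} {x} x≉0 ss≈x = begin
        χ F (n * x)        ≡⟨ χ-cong (trans (*-comm n x) (*-congʳ (sym ss≈x))) ⟩
        χ F ((s * s) * n)  ≡⟨ χ-*-square n s≉0 ⟩
        χ F n              ≡⟨ χ-nonsquare n-nsq ⟩
        -1ℤ                ∎
        where
        open ≡.≡-Reasoning
        s≉0 : s ≉ 0#
        s≉0 s≈0 = x≉0 (trans (sym ss≈x) (trans (*-congʳ s≈0) (zeroˡ s)))
      t : Carrier → ℤ
      t x = ℤ.- (χ F x ℤ.+ χ F (n * x))
      t-cong : t Preserves _≈_ ⟶ _≡_
      t-cong x≈y = ≡.cong ℤ.-_ (≡.cong₂ ℤ._+_ (χ-cong x≈y) (χ-cong (*-congˡ x≈y)))
      t≥0 : ∀ x → 0ℤ ℤ.≤ t x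
      t≥0 x with quadratic x
      ... | is-zero x≈0
        rewrite χ-≈0 x≈0 | χ-≈0 (trans (*-congˡ x≈0) (zeroʳ n)) = ℤ.+≤+ ℕ.z≤n
      ... | is-square x≉0 (s , ss≈x)
        rewrite χ-square x≉0 (s , ss≈x) | χ-n*square x≉0 ss≈x = ℤ.+≤+ ℕ.z≤n
      ... | is-nonsquare x-nsq rewrite χ-nonsquare x-nsq with quadratic (n * x)
      ...   | is-zero nx≈0              rewrite χ-≈0 nx≈0                     = ℤ.+≤+ ℕ.z≤n
      ...   | is-square nx≉0 nx-sq      rewrite χ-square nx≉0 nx-sq          = ℤ.+≤+ ℕ.z≤n
      ...   | is-nonsquare nx-nsq       rewrite χ-nonsquare nx-nsq           = ℤ.+≤+ ℕ.z≤n
      ∑t≡0 : ∑F t ≡ 0ℤ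
      ∑t≡0 = begin
        ∑F t                                       ≡⟨ ∑F-neg _ ⟩
        ℤ.- ∑F (λ x → χ F x ℤ.+ χ F (n * x))       ≡⟨ ≡.cong ℤ.-_ (∑F-+ (χ F) (λ x → χ F (n * x))) ⟩
        ℤ.- (∑F (χ F) ℤ.+ ∑F (λ x → χ F (n * x)))
          ≡⟨ ≡.cong (λ s → ℤ.- (∑F (χ F) ℤ.+ s)) (∑F-reindex-* n≉0 χ-cong) ⟩
        ℤ.- (∑F (χ F) ℤ.+ ∑F (χ F))                ≡⟨ ≡.cong (λ s → ℤ.- (s ℤ.+ s)) ∑χ≡0 ⟩
        0ℤ                                         ∎
        where open ≡.≡-Reasoning

    χ-* : ∀ x y → χ F (x * y) ≡ χ F x ℤ.* χ F y
    χ-* x y with quadratic x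
    ... | is-zero x≈0
      rewrite χ-≈0 x≈0 = χ-≈0 (trans (*-congʳ x≈0) (zeroˡ y))
    ... | is-square x≉0 (s , ss≈x)
      rewrite χ-square x≉0 (s , ss≈x) =
        ≡.trans (χ-cong (*-congʳ (sym ss≈x))) (≡.trans (χ-*-square y s≉0) (≡.sym (ℤP.*-identityˡ (χ F y))))
      where
      s≉0 : s ≉ 0#
      s≉0 s≈0 = x≉0 (trans (sym ss≈x) (trans (*-congʳ s≈0) (zeroˡ s)))
    ... | is-nonsquare x-nsq
      rewrite χ-nonsquare x-nsq = ≡.trans (χ-nonsquare-* x-nsq y) (≡.sym (ℤP.-1*i≡-i (χ F y)))

    -- The bijection u ↦ c * inv u - 1# sends 0# to - 1#; the δ 0# term
    -- corrects for this.
    ∑χ[u]χ[c-u]≡-χ[-1] : ∀ {c} → c ≉ 0# → ∑F (λ u → χ F u ℤ.* χ F (c - u)) ≡ ℤ.- χ F (- 1#)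
    ∑χ[u]χ[c-u]≡-χ[-1] {c} c≉0 = begin
      ∑F (λ u → χ F u ℤ.* χ F (c - u))                               ≡⟨ ∑F-cong pointwise ⟩
      ∑F (λ u → χ F (c * inv u - 1#) ℤ.+ δ 0# u ℤ.* ℤ.- χ F (- 1#))   ≡⟨ ∑F-+ _ _ ⟩
      ∑F (λ u → χ F (c * inv u - 1#)) ℤ.+ ∑F (λ u → δ 0# u ℤ.* ℤ.- χ F (- 1#))
        ≡⟨ ≡.cong₂ ℤ._+_ ∑χ[c/u-1]≡0 (∑F-δ-* 0# (λ _ → ≡.refl)) ⟩
      0ℤ ℤ.+ ℤ.- χ F (- 1#)                                           ≡⟨ ℤP.+-identityˡ _ ⟩
      ℤ.- χ F (- 1#)                                                  ∎
      where
      open ≡.≡-Reasoning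
      ∑χ[c/u-1]≡0 : ∑F (λ u → χ F (c * inv u - 1#)) ≡ 0ℤ
      ∑χ[c/u-1]≡0 = begin
        ∑F (λ u → χ F (c * inv u - 1#))
          ≡⟨ ∑F-reindex-involution inv-cong inv-involutive (λ u≈v → χ-cong (+-congʳ (*-congˡ u≈v))) ⟩
        ∑F (λ u → χ F (c * u - 1#))      ≡⟨ ∑F-reindex-* c≉0 (λ u≈v → χ-cong (+-congʳ u≈v)) ⟩
        ∑F (λ u → χ F (u - 1#))          ≡⟨ ∑F-reindex-+ (- 1#) χ-cong ⟩
        ∑F (χ F)                         ≡⟨ ∑χ≡0 ⟩
        0ℤ                               ∎
      pointwise : ∀ u → χ F u ℤ.* χ F (c - u) ≡ χ F (c * inv u - 1#) ℤ.+ δ 0# u ℤ.* ℤ.- χ F (- 1#)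
      pointwise u = by-cases (u ≟ 0#)
        where
        by-cases : Dec (u ≈ 0#) → χ F u ℤ.* χ F (c - u) ≡ χ F (c * inv u - 1#) ℤ.+ δ 0# u ℤ.* ℤ.- χ F (- 1#)
        by-cases (yes u≈0) = begin
          χ F u ℤ.* χ F (c - u)              ≡⟨ ≡.cong (ℤ._* χ F (c - u)) (χ-≈0 u≈0) ⟩
          0ℤ                                 ≡⟨ ℤP.+-inverseʳ (χ F (- 1#)) ⟨
          χ F (- 1#) ℤ.+ ℤ.- χ F (- 1#)      ≡⟨ ≡.cong₂ ℤ._+_ (χ-cong c/u-1≈-1) δ0-term ⟨
          χ F (c * inv u - 1#) ℤ.+ δ 0# u ℤ.* ℤ.- χ F (- 1#) ∎
          where
          c/u-1≈-1 : c * inv u - 1# ≈ - 1#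
          c/u-1≈-1 = trans (+-congʳ (trans (*-congˡ (inv-≈0 u≈0)) (zeroʳ c))) (+-identityˡ (- 1#))
          δ0-term : δ 0# u ℤ.* ℤ.- χ F (- 1#) ≡ ℤ.- χ F (- 1#)
          δ0-term = ≡.trans (≡.cong (ℤ._* ℤ.- χ F (- 1#)) (𝟙-yes (u ≟ 0#) u≈0)) (ℤP.*-identityˡ _)
        by-cases (no u≉0) = begin
          χ F u ℤ.* χ F (c - u)              ≡⟨ χ-* u (c - u) ⟨
          χ F (u * (c - u))                  ≡⟨ χ-cong (u[c-u]≈uu[c/u-1] c u≉0) ⟩
          χ F ((u * u) * (c * inv u - 1#))   ≡⟨ χ-*-square _ u≉0 ⟩
          χ F (c * inv u - 1#)               ≡⟨ ℤP.+-identityʳ _ ⟨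
          χ F (c * inv u - 1#) ℤ.+ 0ℤ
            ≡⟨ ≡.cong (λ d → χ F (c * inv u - 1#) ℤ.+ d ℤ.* ℤ.- χ F (- 1#)) (𝟙-no (u ≟ 0#) u≉0) ⟨
          χ F (c * inv u - 1#) ℤ.+ δ 0# u ℤ.* ℤ.- χ F (- 1#) ∎

    ∑F[1+χ+δ]≡q+1 : ∑F (λ x → 1ℤ ℤ.+ χ F x ℤ.+ δ 0# x) ≡ + size ℤ.+ 1ℤ
    ∑F[1+χ+δ]≡q+1 = begin
      ∑F (λ x → 1ℤ ℤ.+ χ F x ℤ.+ δ 0# x)
        ≡⟨ ≡.trans (∑F-+ _ (δ 0#)) (≡.cong (ℤ._+ ∑F (δ 0#)) (∑F-+ (λ _ → 1ℤ) (χ F))) ⟩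
      ∑F (λ _ → 1ℤ) ℤ.+ ∑F (χ F) ℤ.+ ∑F (δ 0#)
        ≡⟨ ≡.cong₂ ℤ._+_ (≡.cong₂ ℤ._+_ ∑F-1 ∑χ≡0) (∑F-δ 0#) ⟩
      + size ℤ.+ 0ℤ ℤ.+ 1ℤ                        ≡⟨ ≡.cong (ℤ._+ 1ℤ) (ℤP.+-identityʳ (+ size)) ⟩
      + size ℤ.+ 1ℤ                               ∎
      where open ≡.≡-Reasoning

    module QuarticImage (a : Carrier) (a≉0 : a ≉ 0#) where

      σ : Carrier → Carrier
      σ u = - a - u

      σ-cong : σ Preserves _≈_ ⟶ _≈_
      σ-cong u≈v = +-congˡ (-‿cong u≈v)

      σ-involutive : ∀ u → σ (σ u) ≈ u
      σ-involutive u = solve 2 (λ a u → (:- a) :- ((:- a) :- u) := u) refl a u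

      h : Carrier → Carrier
      h u = u * u + a * u

      h-cong : h Preserves _≈_ ⟶ _≈_
      h-cong u≈v = +-cong (*-cong u≈v u≈v) (*-congˡ u≈v)

      h∘σ≈h : ∀ u → h (σ u) ≈ h u
      h∘σ≈h u = solve 2 (λ a u → ((:- a) :- u) :* ((:- a) :- u) :+ a :* ((:- a) :- u) := u :* u :+ a :* u)
                        refl a u

      h-fibre : ∀ {u v} → h u ≈ h v → v ≈ u ⊎ v ≈ σ u
      h-fibre {u} {v} hu≈hv with zero-product {u - v} {u + v + a} factored
        where
        factored : (u - v) * (u + v + a) ≈ 0#
        factored = trans (solve 3 (λ a u v → (u :- v) :* (u :+ v :+ a) := (u :* u :+ a :* u) :- (v :* v :+ a :* v))
                                  refl a u v)
                         (trans (+-congʳ hu≈hv) (-‿inverseʳ (h v)))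
      ... | inj₁ u-v≈0   = inj₁ (sym (x∙y⁻¹≈ε⇒x≈y u v u-v≈0))
      ... | inj₂ u+v+a≈0 = inj₂ (x∙y⁻¹≈ε⇒x≈y v (σ u)
                                  (trans (solve 3 (λ a u v → v :- ((:- a) :- u) := u :+ v :+ a) refl a u v) u+v+a≈0))

      c : Carrier
      c = inv 2# * - a

      2c≈-a : 2# * c ≈ - a
      2c≈-a = trans (sym (*-assoc 2# (inv 2#) (- a))) (trans (*-congʳ (*-inv 2≉0)) (*-identityˡ (- a)))

      σc≈c : σ c ≈ c
      σc≈c = trans (+-congʳ (sym 2c≈-a)) (solve 1 (λ c → con (+ 2) :* c :- c := c) refl c)

      σu≈u⇒u≈c : ∀ {u} → σ u ≈ u → u ≈ c
      σu≈u⇒u≈c {u} σu≈u = *-solveˡ 2≉0 (begin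
        2# * u      ≈⟨ solve 1 (λ u → con (+ 2) :* u := u :+ u) refl u ⟩
        u + u       ≈⟨ +-congˡ σu≈u ⟨
        u + σ u     ≈⟨ solve 2 (λ a u → u :+ ((:- a) :- u) := :- a) refl a u ⟩
        - a         ∎)
        where open ≈-Reasoning

      -- Selects one square from each fibre {u, σ u} of h on the squares.
      Canonical : Carrier → Set
      Canonical u = Square u × ¬ (Square (σ u) × index (σ u) Fin.< index u)

      canonical? : ∀ u → Dec (Canonical u)
      canonical? u = isSquare? F u ×-dec ¬? (isSquare? F (σ u) ×-dec (index (σ u) FinP.<? index u))

      canonical-cong : ∀ {u v} → u ≈ v → Canonical u → Canonical v
      canonical-cong u≈v (u-sq , u-min) = square-cong u≈v u-sq , λ (σv-sq , σv<v) →
        u-min (square-cong (σ-cong (sym u≈v)) σv-sq ,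
               ≡.subst₂ Fin._<_ (index-cong (σ-cong (sym u≈v))) (index-cong (sym u≈v)) σv<v)

      canonical-representative : ∀ u → Square u → ∃ λ v → Canonical v × h v ≈ h u
      canonical-representative u u-sq with isSquare? F (σ u) ×-dec (index (σ u) FinP.<? index u)
      ... | no u-min = u , (u-sq , u-min) , refl
      ... | yes (σu-sq , σu<u) = σ u , (σu-sq , σu-min) , h∘σ≈h u
        where
        σu-min : ¬ (Square (σ (σ u)) × index (σ (σ u)) Fin.< index (σ u))
        σu-min (_ , σσu<σu) = FinP.<-asym σu<u (≡.subst (Fin._< index (σ u)) (index-cong (σ-involutive u)) σσu<σu)

      canonical-injective : ∀ {u v} → Canonical u → Canonical v → h u ≈ h v → u ≈ v
      canonical-injective {u} {v} (u-sq , u-min) (v-sq , v-min) hu≈hv with h-fibre hu≈hv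
      ... | inj₁ v≈u = sym v≈u
      ... | inj₂ v≈σu with FinP.<-cmp (index (σ u)) (index u)
      ...   | tri< σu<u _ _ = ⊥-elim (u-min (square-cong v≈σu v-sq , σu<u))
      ...   | tri≈ _ σu≡u _ = trans (sym (index-injective σu≡u)) (sym v≈σu)
      ...   | tri> _ _ u<σu = ⊥-elim (v-min (square-cong (sym σv≈u) u-sq ,
        ≡.subst₂ Fin._<_ (≡.sym (index-cong σv≈u)) (≡.sym (index-cong v≈σu)) u<σu))
        where
        σv≈u : σ v ≈ u
        σv≈u = trans (σ-cong v≈σu) (σ-involutive u)

      f : Carrier → Carrier
      f x = (x * x) * (x * x) + a * (x * x)

      imageSize≡#canonical : imageSize F f ≡ countFin (λ i → canonical? (enum i))
      imageSize≡#canonical = ≡.sym (bijection⇒count≡ (canonical? ∘ enum) (λ i → FinP.any? (λ j → f (enum j) ≟ enum i))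
                                                     (lift h) in-image injective onto)
        where
        in-image : ∀ i → Canonical (enum i) → ∃ λ j → f (enum j) ≈ enum (lift h i)
        in-image i ((y , yy≈u) , _) = index y , (begin
          h (enum (index y) * enum (index y))  ≈⟨ h-cong (*-cong (enum-index y) (enum-index y)) ⟩
          h (y * y)                            ≈⟨ h-cong yy≈u ⟩
          h (enum i)                           ≈⟨ enum-index (h (enum i)) ⟨
          enum (lift h i)                      ∎)
          where open ≈-Reasoning
        injective : ∀ i j → Canonical (enum i) → Canonical (enum j) → lift h i ≡ lift h j → i ≡ j
        injective i j i-can j-can eq = enum-inj i j (canonical-injective i-can j-can (index-injective eq))
        onto : ∀ j → (∃ λ k → f (enum k) ≈ enum j) → ∃ λ i → Canonical (enum i) × lift h i ≡ j
        onto j (k , fk≈j) =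
          let v , v-can , hv≈h = canonical-representative (enum k * enum k) (enum k , refl)
          in index v , canonical-cong (sym (enum-index v)) v-can ,
             ≡.trans (index-cong (trans (h-cong (enum-index v)) (trans hv≈h fk≈j))) (index-enum j)

      σ̂ : Fin size → Fin size
      σ̂ = lift σ

      σ̂-involutive : ∀ i → σ̂ (σ̂ i) ≡ i
      σ̂-involutive = lift-inverse σ-cong σ-involutive

      w : Fin size → ℤ
      w i = 𝟙Sq (enum i) ℤ.* 𝟙Sq (σ (enum i))

      w∘σ̂ : ∀ i → w (σ̂ i) ≡ w i
      w∘σ̂ i = ≡.trans (≡.cong₂ ℤ._*_ (𝟙Sq-cong σ̂i≈σi) (𝟙Sq-cong (trans (σ-cong σ̂i≈σi) (σ-involutive _))))
                      (ℤP.*-comm (𝟙Sq (σ (enum i))) (𝟙Sq (enum i)))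
        where
        σ̂i≈σi : enum (σ̂ i) ≈ σ (enum i)
        σ̂i≈σi = enum-index (σ (enum i))

      -- A counts the orbits {u, σ u} of squares with u ≉ σ u, B the fixed point c.
      S T A B : ℤ
      S = ∑F 𝟙Sq
      T = ∑F (λ u → 𝟙Sq u ℤ.* 𝟙Sq (σ u))
      A = sum (λ i → w i ℤ.* 𝟙 (σ̂ i FinP.<? i))
      B = sum (λ i → w i ℤ.* 𝟙 (i FinP.≟ σ̂ i))

      𝟙-canonical : ∀ i → 𝟙 (canonical? (enum i)) ≡ 𝟙Sq (enum i) ℤ.- w i ℤ.* 𝟙 (σ̂ i FinP.<? i)
      𝟙-canonical i = begin
        𝟙 (canonical? (enum i))
          ≡⟨ 𝟙-× (isSquare? F (enum i)) _ ⟩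
        𝟙Sq (enum i) ℤ.* 𝟙 (¬? (isSquare? F (σ (enum i)) ×-dec (σ̂ i FinP.<? index (enum i))))
          ≡⟨ ≡.cong (ℤ._*_ (𝟙Sq (enum i))) (≡.trans (𝟙-¬ (sq ×-dec lt)) (≡.cong (ℤ._-_ 1ℤ) (𝟙-× sq lt))) ⟩
        𝟙Sq (enum i) ℤ.* (1ℤ ℤ.- 𝟙Sq (σ (enum i)) ℤ.* 𝟙 (σ̂ i FinP.<? index (enum i)))
          ≡⟨ ≡.cong (λ k → 𝟙Sq (enum i) ℤ.* (1ℤ ℤ.- 𝟙Sq (σ (enum i)) ℤ.* 𝟙 (σ̂ i FinP.<? k))) (index-enum i) ⟩
        𝟙Sq (enum i) ℤ.* (1ℤ ℤ.- 𝟙Sq (σ (enum i)) ℤ.* 𝟙 (σ̂ i FinP.<? i))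
          ≡⟨ x[1-yz]≡x-xyz (𝟙Sq (enum i)) (𝟙Sq (σ (enum i))) (𝟙 (σ̂ i FinP.<? i)) ⟩
        𝟙Sq (enum i) ℤ.- w i ℤ.* 𝟙 (σ̂ i FinP.<? i)
          ∎
        where
        open ≡.≡-Reasoning
        sq : Dec (Square (σ (enum i)))
        sq = isSquare? F (σ (enum i))
        lt : Dec (σ̂ i Fin.< index (enum i))
        lt = σ̂ i FinP.<? index (enum i)
        x[1-yz]≡x-xyz : ∀ x y z → x ℤ.* (1ℤ ℤ.- y ℤ.* z) ≡ x ℤ.- x ℤ.* y ℤ.* z
        x[1-yz]≡x-xyz = solve-∀

      N≡S-A : + imageSize F f ≡ S ℤ.- A
      N≡S-A = begin
        + imageSize F f                                           ≡⟨ ≡.cong +_ imageSize≡#canonical ⟩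
        + countFin (λ i → canonical? (enum i))                    ≡⟨ count≡∑𝟙 (canonical? ∘ enum) ⟩
        sum (λ i → 𝟙 (canonical? (enum i)))                       ≡⟨ sum-cong-≗ 𝟙-canonical ⟩
        sum (λ i → 𝟙Sq (enum i) ℤ.- w i ℤ.* 𝟙 (σ̂ i FinP.<? i))    ≡⟨ ∑-distrib-+ (𝟙Sq ∘ enum) _ ⟩
        sum (𝟙Sq ∘ enum) ℤ.+ sum (λ i → ℤ.- (w i ℤ.* 𝟙 (σ̂ i FinP.<? i)))
          ≡⟨ ≡.cong₂ ℤ._+_ (≡.sym (∑F-def 𝟙Sq)) (∑-neg (λ i → w i ℤ.* 𝟙 (σ̂ i FinP.<? i))) ⟩
        S ℤ.- A                                                   ∎
        where open ≡.≡-Reasoning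

      T≡2A+B : T ≡ + 2 ℤ.* A ℤ.+ B
      T≡2A+B = ≡.trans (∑F-def _) (∑-involution σ̂ σ̂-involutive w w∘σ̂)

      2S≡q+1 : + 2 ℤ.* S ≡ + size ℤ.+ 1ℤ
      2S≡q+1 = ≡.trans (≡.sym (∑F-*ˡ (+ 2) 𝟙Sq)) (≡.trans (∑F-cong 2𝟙Sq≡1+χ+δ) ∑F[1+χ+δ]≡q+1)

      𝟙-fixed : ∀ i → 𝟙 (i FinP.≟ σ̂ i) ≡ δ c (enum i)
      𝟙-fixed i = 𝟙-⇔ _ _ fixed⇒≈c ≈c⇒fixed
        where
        fixed⇒≈c : i ≡ σ̂ i → enum i ≈ c
        fixed⇒≈c i≡σ̂i = σu≈u⇒u≈c (trans (sym (enum-index _)) (reflexive (≡.cong enum (≡.sym i≡σ̂i))))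
        ≈c⇒fixed : enum i ≈ c → i ≡ σ̂ i
        ≈c⇒fixed i≈c = ≡.sym (≡.trans (index-cong (trans (σ-cong i≈c) (trans σc≈c (sym i≈c)))) (index-enum i))

      B≡𝟙Sq-c : B ≡ 𝟙Sq c
      B≡𝟙Sq-c = begin
        B
          ≡⟨ sum-cong-≗ (λ i → ≡.trans (≡.cong (ℤ._*_ (w i)) (𝟙-fixed i)) (ℤP.*-comm (w i) _)) ⟩
        sum (λ i → δ c (enum i) ℤ.* w i)
          ≡⟨ ∑F-def (λ u → δ c u ℤ.* (𝟙Sq u ℤ.* 𝟙Sq (σ u))) ⟨
        ∑F (λ u → δ c u ℤ.* (𝟙Sq u ℤ.* 𝟙Sq (σ u)))
          ≡⟨ ∑F-δ-* c (λ u≈v → ≡.cong₂ ℤ._*_ (𝟙Sq-cong u≈v) (𝟙Sq-cong (σ-cong u≈v))) ⟩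
        𝟙Sq c ℤ.* 𝟙Sq (σ c)
          ≡⟨ ≡.cong (ℤ._*_ (𝟙Sq c)) (𝟙Sq-cong σc≈c) ⟩
        𝟙Sq c ℤ.* 𝟙Sq c
          ≡⟨ 𝟙-idem (isSquare? F c) ⟩
        𝟙Sq c
          ∎
        where open ≡.≡-Reasoning

      -a≉0 : - a ≉ 0#
      -a≉0 = a≉0 ∘ -x≈0⇒x≈0

      c≉0 : c ≉ 0#
      c≉0 = *-≉0 (inv-≉0 2≉0) -a≉0

      c≈¼[-2a] : c ≈ (inv 2# * inv 2#) * - (2# * a)
      c≈¼[-2a] = begin
        inv 2# * - a                         ≈⟨ *-identityʳ _ ⟨
        (inv 2# * - a) * 1#                  ≈⟨ *-congˡ (*-inv 2≉0) ⟨
        (inv 2# * - a) * (2# * inv 2#)       ≈⟨ solve 2 (λ a ½ → (½ :* (:- a)) :* (con (+ 2) :* ½)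
                                                              := (½ :* ½) :* (:- (con (+ 2) :* a))) refl a (inv 2#) ⟩
        (inv 2# * inv 2#) * - (2# * a)       ∎
        where open ≈-Reasoning

      2B≡1+χ[-2a] : + 2 ℤ.* B ≡ 1ℤ ℤ.+ χ F (- (2# * a))
      2B≡1+χ[-2a] = begin
        + 2 ℤ.* B                          ≡⟨ ≡.cong (ℤ._*_ (+ 2)) B≡𝟙Sq-c ⟩
        + 2 ℤ.* 𝟙Sq c                      ≡⟨ 2𝟙Sq≡1+χ+δ c ⟩
        1ℤ ℤ.+ χ F c ℤ.+ δ 0# c            ≡⟨ ≡.cong₂ (λ x d → 1ℤ ℤ.+ x ℤ.+ d) χc≡χ[-2a] (𝟙-no (c ≟ 0#) c≉0) ⟩
        1ℤ ℤ.+ χ F (- (2# * a)) ℤ.+ 0ℤ     ≡⟨ ℤP.+-identityʳ _ ⟩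
        1ℤ ℤ.+ χ F (- (2# * a))            ∎
        where
        open ≡.≡-Reasoning
        χc≡χ[-2a] : χ F c ≡ χ F (- (2# * a))
        χc≡χ[-2a] = ≡.trans (χ-cong c≈¼[-2a]) (χ-*-square _ (inv-≉0 2≉0))

      g : Carrier → ℤ
      g u = 1ℤ ℤ.+ χ F (σ u) ℤ.+ δ 0# (σ u)

      1+χ+δ-cong : (λ u → 1ℤ ℤ.+ χ F u ℤ.+ δ 0# u) Preserves _≈_ ⟶ _≡_
      1+χ+δ-cong u≈v = ≡.cong₂ ℤ._+_ (≡.cong (ℤ._+_ 1ℤ) (χ-cong u≈v)) (δ-cong 0# u≈v)

      ∑g : ∑F g ≡ + size ℤ.+ 1ℤ
      ∑g = ≡.trans (∑F-reindex-involution σ-cong σ-involutive 1+χ+δ-cong) ∑F[1+χ+δ]≡q+1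

      σ0≈-a : σ 0# ≈ - a
      σ0≈-a = solve 1 (λ a → (:- a) :- con 0ℤ := :- a) refl a

      g0 : g 0# ≡ 1ℤ ℤ.+ χ F (- a)
      g0 = ≡.trans (≡.cong₂ ℤ._+_ (≡.cong (ℤ._+_ 1ℤ) (χ-cong σ0≈-a)) (𝟙-no _ (-a≉0 ∘ trans (sym σ0≈-a))))
                   (ℤP.+-identityʳ _)

      δ0∘σ≡δ-a : ∀ u → δ 0# (σ u) ≡ δ (- a) u
      δ0∘σ≡δ-a u = 𝟙-⇔ _ _ (λ σu≈0 → trans (sym (σ-involutive u)) (trans (σ-cong σu≈0) σ0≈-a))
                           (λ u≈-a → trans (σ-cong u≈-a) (solve 1 (λ a → (:- a) :- (:- a) := con 0ℤ) refl a))

      ∑χg : ∑F (λ u → χ F u ℤ.* g u) ≡ ℤ.- χ F (- 1#) ℤ.+ χ F (- a)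
      ∑χg = begin
        ∑F (λ u → χ F u ℤ.* g u)
          ≡⟨ ∑F-cong (λ u → ≡.trans (*-distribˡ-+₃ (χ F u) 1ℤ (χ F (σ u)) (δ 0# (σ u)))
                                    (≡.cong (λ t → t ℤ.+ χ F u ℤ.* χ F (σ u) ℤ.+ χ F u ℤ.* δ 0# (σ u))
                                            (ℤP.*-identityʳ (χ F u)))) ⟩
        ∑F (λ u → χ F u ℤ.+ χ F u ℤ.* χ F (σ u) ℤ.+ χ F u ℤ.* δ 0# (σ u))
          ≡⟨ ≡.trans (∑F-+ _ (λ u → χ F u ℤ.* δ 0# (σ u)))
                     (≡.cong (ℤ._+ ∑F (λ u → χ F u ℤ.* δ 0# (σ u))) (∑F-+ (χ F) (λ u → χ F u ℤ.* χ F (σ u)))) ⟩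
        ∑F (χ F) ℤ.+ ∑F (λ u → χ F u ℤ.* χ F (σ u)) ℤ.+ ∑F (λ u → χ F u ℤ.* δ 0# (σ u))
          ≡⟨ ≡.cong₂ ℤ._+_ (≡.cong₂ ℤ._+_ ∑χ≡0 (∑χ[u]χ[c-u]≡-χ[-1] -a≉0)) ∑χδ∘σ ⟩
        0ℤ ℤ.+ ℤ.- χ F (- 1#) ℤ.+ χ F (- a)
          ≡⟨ ≡.cong (ℤ._+ χ F (- a)) (ℤP.+-identityˡ (ℤ.- χ F (- 1#))) ⟩
        ℤ.- χ F (- 1#) ℤ.+ χ F (- a)
          ∎
        where
        open ≡.≡-Reasoning
        ∑χδ∘σ : ∑F (λ u → χ F u ℤ.* δ 0# (σ u)) ≡ χ F (- a)
        ∑χδ∘σ = ≡.trans (∑F-cong (λ u → ≡.trans (ℤP.*-comm (χ F u) _) (≡.cong (ℤ._* χ F u) (δ0∘σ≡δ-a u))))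
                        (∑F-δ-* (- a) χ-cong)

      4T≡q+2+2χ[-a]-χ[-1] : + 4 ℤ.* T ≡ + size ℤ.+ + 2 ℤ.+ + 2 ℤ.* χ F (- a) ℤ.- χ F (- 1#)
      4T≡q+2+2χ[-a]-χ[-1] = begin
        + 4 ℤ.* T
          ≡⟨ ∑F-*ˡ (+ 4) _ ⟨
        ∑F (λ u → + 4 ℤ.* (𝟙Sq u ℤ.* 𝟙Sq (σ u)))
          ≡⟨ ∑F-cong (λ u → ≡.trans (4xy≡2x*2y (𝟙Sq u) (𝟙Sq (σ u)))
                                    (≡.cong₂ ℤ._*_ (2𝟙Sq≡1+χ+δ u) (2𝟙Sq≡1+χ+δ (σ u)))) ⟩
        ∑F (λ u → (1ℤ ℤ.+ χ F u ℤ.+ δ 0# u) ℤ.* g u)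
          ≡⟨ ∑F-[1+χ+δ]* (1+χ+δ-cong ∘ σ-cong) ⟩
        ∑F g ℤ.+ ∑F (λ u → χ F u ℤ.* g u) ℤ.+ g 0#
          ≡⟨ ≡.cong₂ ℤ._+_ (≡.cong₂ ℤ._+_ ∑g ∑χg) g0 ⟩
        + size ℤ.+ 1ℤ ℤ.+ (ℤ.- χ F (- 1#) ℤ.+ χ F (- a)) ℤ.+ (1ℤ ℤ.+ χ F (- a))
          ≡⟨ collect (+ size) (χ F (- a)) (χ F (- 1#)) ⟩
        + size ℤ.+ + 2 ℤ.+ + 2 ℤ.* χ F (- a) ℤ.- χ F (- 1#)
          ∎
        where
        open ≡.≡-Reasoning
        4xy≡2x*2y : ∀ x y → + 4 ℤ.* (x ℤ.* y) ≡ (+ 2 ℤ.* x) ℤ.* (+ 2 ℤ.* y)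
        4xy≡2x*2y = solve-∀
        collect : ∀ q x y → q ℤ.+ 1ℤ ℤ.+ (ℤ.- y ℤ.+ x) ℤ.+ (1ℤ ℤ.+ x) ≡ q ℤ.+ + 2 ℤ.+ + 2 ℤ.* x ℤ.- y
        collect = solve-∀

      8N≡3q+4+χ[-1]-2χ[-a]+2χ[-2a] :
        + 8 ℤ.* + imageSize F f
          ≡ + 3 ℤ.* + size ℤ.+ + 4 ℤ.+ χ F (- 1#) ℤ.- + 2 ℤ.* χ F (- a) ℤ.+ + 2 ℤ.* χ F (- (2# * a))
      8N≡3q+4+χ[-1]-2χ[-a]+2χ[-2a] =
        ≡.trans (≡.cong (ℤ._*_ (+ 8)) N≡S-A)
                (8[s-x]≡3q+4+Y-2X+2Z {q = + size} {χ F (- a)} {χ F (- 1#)} {χ F (- (2# * a))}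
                           2S≡q+1 T≡2A+B 4T≡q+2+2χ[-a]-χ[-1] 2B≡1+χ[-2a])

lemma3p1 : (F : FiniteField) → let open FiniteField F in
    size % 2 ≡ 1 →
    (a : Carrier) → ¬ (a ≈ 0#) →
    let N = imageSize F (λ x → (x * x) * (x * x) + a * (x * x))
        q = + size
    in ((+ 8) ℤ.* (+ N) ≡ (+ 3) ℤ.* q ℤ.+ (+ 4) ℤ.+ χ F (- 1#) ℤ.- (+ 2) ℤ.* χ F (- a) ℤ.+ (+ 2) ℤ.* χ F (- ((1# + 1#) * a)))
     × ((+ N) ≡ ((+ 3) ℤ.* q ℤ.+ (+ 7) ℤ.- (+ 2) ℤ.* χ F (- a)) / (+ 8))
lemma3p1 F odd a a≉0 =
  8N≡3q+4+χ[-1]-2χ[-a]+2χ[-2a] ,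
  N≡⌊[3q+7-2x]/8⌋ {q = + size} {x = χ F (- a)} 8N≡3q+4+χ[-1]-2χ[-a]+2χ[-2a] (χ-±1 -1≉0) (χ-±1 -2a≉0)
  where
  open FiniteField F
  open FiniteFieldTheory F
  open OddCharacteristic (odd-size⇒2≉0 odd)
  open QuarticImage a a≉0
  -1≉0 : - 1# ≉ 0#
  -1≉0 = 1≉0 ∘ -x≈0⇒x≈0
  -2a≉0 : - (2# * a) ≉ 0#
  -2a≉0 = *-≉0 (odd-size⇒2≉0 odd) a≉0 ∘ -x≈0⇒x≈0
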